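{- Let $q=p^s$ be a prime power. Let $A,B\subset\mathbb{F}_q$ with $|A|=m$, $|B|=n$, where $m,n\ge2$ are integers such that $p\nmid m$ and $0<k=q-mn<n-1$. Then the number of directions determined by $A\times B\subset AG(2,q)$ is at least $mn-n+2$. In particular, if $p\nmid m$, $2\le m\le\sqrt q-1$ and $n=\lfloor q/m\rfloor$, then the number of directions determined by $A\times B$ is at least $mn-n+2$.
   Context: The set of directions determined by $A\times B\subset AG(2,q)$ is $\{\frac{y_2-y_1}{x_2-x_1}: x_1,x_2\in A,\ y_1,y_2\in B,\ (x_1,y_1)\neq(x_2,y_2)\}\subset\mathbb{F}_q\cup\{\infty\}$ ($c/0=\infty$). -}

module Defs where

open import Level using (0ℓ)
open import Data.Nat using (ℕ)
open import Data.Fin using (Fin)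
open import Data.Maybe using (Maybe; just; nothing)
open import Data.Product using (∃; _×_; _,_)
open import Data.Sum using (_⊎_)
open import Function.Bundles using (_↔_)
open import Function.Definitions using (Injective)
open import Relation.Nullary using (¬_)
open import Relation.Binary.PropositionalEquality using (_≡_)
open import Algebra.Structures using (IsCommutativeRing)

-- A field with propositional equality.  The inverse is a total function
-- (the value at 0 is irrelevant); it is a two-sided inverse on nonzero elements.
record Field : Set₁ where
  infixl 6 _+_ _-_
  infixl 7 _*_
  field
    Carrier : Set
    _+_ _*_ : Carrier → Carrier → Carrier
    -_ : Carrier → Carrier
    0# 1# : Carrier
    _⁻¹ : Carrier → Carrier
    isCommutativeRing : IsCommutativeRing _≡_ _+_ _*_ -_ 0# 1#
    0≢1 : ¬ (0# ≡ 1#)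
    *-inverse : ∀ x → ¬ (x ≡ 0#) → x * (x ⁻¹) ≡ 1#

  _-_ : Carrier → Carrier → Carrier
  x - y = x + (- y)

HasSize : Field → ℕ → Set
HasSize F q = Fin q ↔ Field.Carrier F

record Subset (F : Field) (m : ℕ) : Set where
  field
    elem : Fin m → Field.Carrier F
    elem-inj : Injective _≡_ _≡_ elem

_∈ˢ_ : {F : Field} {m : ℕ} → Field.Carrier F → Subset F m → Set
_∈ˢ_ {m = m} x A = ∃ λ (i : Fin m) → Subset.elem A i ≡ x

-- d ∈ F ∪ {∞} (∞ = nothing) is a direction determined by A × B:
-- there are (x₁,y₁) ≠ (x₂,y₂) in A × B with d = (y₂ - y₁)/(x₂ - x₁), c/0 = ∞.
IsDirection : (F : Field) {m n : ℕ} → Subset F m → Subset F n → Maybe (Field.Carrier F) → Set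
IsDirection F A B d =
  ∃ λ x₁ → ∃ λ x₂ → ∃ λ y₁ → ∃ λ y₂ →
    x₁ ∈ˢ A × x₂ ∈ˢ A × y₁ ∈ˢ B × y₂ ∈ˢ B ×
    ¬ ((x₁ , y₁) ≡ (x₂ , y₂)) ×
    ((x₁ ≡ x₂ × d ≡ nothing) ⊎
     (¬ (x₁ ≡ x₂) × d ≡ just ((y₂ - y₁) * ((x₂ - x₁) ⁻¹))))
  where open Field F

AtLeastDirections : (F : Field) {m n : ℕ} → Subset F m → Subset F n → ℕ → Set
AtLeastDirections F A B N =
  ∃ λ (f : Fin N → Maybe (Field.Carrier F)) →
    Injective _≡_ _≡_ f × (∀ i → IsDirection F A B (f i))

module Submission where

-- Translate B so that 0 ∉ B.  For d ∈ F consider the m n intercepts b - d a (a ∈ A, b ∈ B).  If d is not a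
-- direction they are distinct, and for a list L of distinct elements the complete homogeneous symmetric
-- polynomials h_i(L) vanish for q - |L| < i < q - 1, since ∏_{x ∈ F} (1 - x z) ≡ 1 mod z^(q-1) while
-- ∏_{x ∉ L} (1 - x z) has degree q - |L|.  As a function of d, h_i of the intercepts is a polynomial of degree
-- at most i whose value at d = 0 is h_i(B, …, B) (B repeated m times).  This value is nonzero for some
-- k < i < k + n: otherwise the truncation P of ∏_{b ∈ B} (1 - b z)^(-m) at degree k makes
-- (∏ (1 - b z)^m P)′ vanish except in degree k + m n - 1, where the coefficient is divisible by q; dividing by
-- ∏ (1 - b z)^(m-1) shows that ∏ (1 - b z) P′ + m (∏ (1 - b z))′ P = 0, so P, of degree k < n - 1 and with P(0) = 1,
-- vanishes at the n points 1/b.  Hence at most i ≤ k + n - 1 elements of F are not directions, which leaves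
-- m n - n + 1 finite directions besides ∞.

open import Defs
open import Data.Nat as ℕ using (ℕ; zero; suc; _≤_; _<_; _∸_; z≤n; s≤s)
import Data.Nat.Properties as ℕ
open import Data.Nat.Tactic.RingSolver using (solve-∀)
open import Data.Integer as ℤ using (ℤ; -[1+_]; _⊖_) renaming (+_ to pos)
import Data.Integer.Properties as ℤ
open import Data.Fin as Fin using (Fin)
import Data.Fin.Properties as Fin
open import Data.List using (List; []; _∷_; _++_; length; map; filter; foldr; tabulate; concat; replicate; cartesianProduct; lookup; allFin)
open import Data.List.Properties using (foldr-++; ++-identityʳ; length-++; length-map; length-tabulate; map-++; map-cong; map-∘)
open import Data.List.Relation.Unary.All as All using (All; []; _∷_)
import Data.List.Relation.Unary.All.Properties as All
open import Data.List.Relation.Unary.Any as Any using (Any; here; there)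
open import Data.List.Relation.Unary.AllPairs using ([]; _∷_)
open import Data.List.Relation.Unary.Unique.Propositional using (Unique)
import Data.List.Relation.Unary.Unique.Propositional.Properties as Unique
open import Data.List.Membership.Propositional using (_∈_; lose)
open import Data.List.Membership.Propositional.Properties using (∈-tabulate⁺; ∈-map⁺; ∈-filter⁺; ∈-filter⁻; ∈-++⁺ˡ; ∈-++⁺ʳ; ∈-lookup; ∈-allFin; ∈-cartesianProduct⁺)
open import Data.List.Membership.Propositional.Properties.WithK using (unique∧set⇒bag)
open import Data.List.Relation.Binary.BagAndSetEquality using (∼bag⇒↭)
open import Data.List.Relation.Binary.Permutation.Propositional as ↭ using (_↭_; ↭⇒↭ₛ)
open import Data.List.Relation.Binary.Permutation.Propositional.Properties using (↭-length; ++-comm)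
import Data.List.Relation.Binary.Permutation.Setoid.Properties as Permutationₛ
open import Data.Maybe using (Maybe; just; nothing)
open import Data.Maybe.Properties using (just-injective)
open import Data.Product using (Σ; ∃; _×_; _,_; proj₁; proj₂)
open import Data.Product.Properties using (≡-dec)
open import Data.Sum using (inj₁; inj₂)
open import Data.Empty using (⊥; ⊥-elim)
open import Data.Nat.Divisibility using (_∣_)
open import Data.Nat.Primality using (Prime; prime⇒irreducible)
open import Data.Nat.Coprimality using (Coprime; coprime-Bézout; coprime-divisor)
open import Data.Nat.GCD using (module Bézout)
open import Algebra.Bundles using (CommutativeRing)
open import Algebra.Solver.Ring.AlmostCommutativeRing using (AlmostCommutativeRing; fromCommutativeRing; _-Raw-AlmostCommutative⟶_)
open import Function.Base using (_∘_; case_of_)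
open import Function.Bundles using (Inverse; mk⇔)
open import Function.Definitions using (Injective)
open import Relation.Binary.Bundles using (Setoid)
open import Relation.Binary.Definitions using (DecidableEquality; tri<; tri≈; tri>)
import Relation.Binary.Reasoning.Setoid as SetoidReasoning
open import Relation.Binary.PropositionalEquality
open import Relation.Nullary using (¬_; yes; no; ¬?; Dec)
open import Relation.Nullary.Decidable using (_×-dec_; decidable-stable)
open import Relation.Unary using (Decidable)

module _ {A : Set} where

  length-filter+filter∁ : ∀ {P : A → Set} (P? : Decidable P) xs →
    length (filter P? xs) ℕ.+ length (filter (λ x → ¬? (P? x)) xs) ≡ length xs
  length-filter+filter∁ P? []       = refl
  length-filter+filter∁ P? (x ∷ xs) with P? x
  ... | yes _ = cong suc (length-filter+filter∁ P? xs)
  ... | no  _ = trans (ℕ.+-suc _ _) (cong suc (length-filter+filter∁ P? xs))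

  ↭-unique : {xs ys : List A} → Unique xs → Unique ys → (∀ {x} → x ∈ xs → x ∈ ys) → (∀ {x} → x ∈ ys → x ∈ xs) → xs ↭ ys
  ↭-unique xs! ys! xs⊆ys ys⊆xs = ∼bag⇒↭ (unique∧set⇒bag xs! ys! (mk⇔ xs⊆ys ys⊆xs))

  ∃-∈ : ∀ {xs : List A} → 1 ≤ length xs → ∃ λ x → x ∈ xs
  ∃-∈ {x ∷ _} _ = x , here refl

  ∃-≢ : DecidableEquality A → ∀ {xs : List A} (z : A) → Unique xs → 2 ≤ length xs → ∃ λ x → x ∈ xs × ¬ (x ≡ z)
  ∃-≢ _≟_ {a ∷ b ∷ _} z ((a≢b ∷ _) ∷ _) _ with a ≟ z
  ... | no  a≢z  = a , here refl , a≢z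
  ... | yes refl = b , there (here refl) , λ b≡a → a≢b (sym b≡a)
  ∃-≢ _≟_ {_ ∷ []} z _ (s≤s ())

  lookup-injective : ∀ {xs : List A} → Unique xs → ∀ i j → lookup xs i ≡ lookup xs j → i ≡ j
  lookup-injective {_ ∷ _} _            Fin.zero    Fin.zero    _  = refl
  lookup-injective {_ ∷ _} (x∉xs ∷ _)   Fin.zero    (Fin.suc j) eq = ⊥-elim (All.lookup x∉xs (∈-lookup j) eq)
  lookup-injective {_ ∷ _} (x∉xs ∷ _)   (Fin.suc i) Fin.zero    eq = ⊥-elim (All.lookup x∉xs (∈-lookup i) (sym eq))
  lookup-injective {_ ∷ _} (_ ∷ xs!)    (Fin.suc i) (Fin.suc j) eq = cong Fin.suc (lookup-injective xs! i j eq)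

  length-concat-replicate : ∀ m (xs : List A) → length (concat (replicate m xs)) ≡ m ℕ.* length xs
  length-concat-replicate zero    xs = refl
  length-concat-replicate (suc m) xs = trans (length-++ xs) (cong (length xs ℕ.+_) (length-concat-replicate m xs))

module _ {I J : Set} where

  length-cartesianProduct : (xs : List I) (ys : List J) → length (cartesianProduct xs ys) ≡ length xs ℕ.* length ys
  length-cartesianProduct []       ys = refl
  length-cartesianProduct (x ∷ xs) ys =
    trans (length-++ (map (x ,_) ys)) (cong₂ ℕ._+_ (length-map _ ys) (length-cartesianProduct xs ys))

  map-cartesianProduct-proj₂ : ∀ {C : Set} (f : I × J → C) (g : J → C) → (∀ x y → f (x , y) ≡ g y) →
    ∀ xs ys → map f (cartesianProduct xs ys) ≡ concat (replicate (length xs) (map g ys))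
  map-cartesianProduct-proj₂ f g f≡g []       ys = refl
  map-cartesianProduct-proj₂ f g f≡g (x ∷ xs) ys =
    trans (map-++ f (map (x ,_) ys) _)
          (cong₂ _++_ (trans (sym (map-∘ ys)) (map-cong (f≡g x) ys)) (map-cartesianProduct-proj₂ f g f≡g xs ys))


module FieldProperties (F : Field) where
  open Field F

  commutativeRing : CommutativeRing _ _
  commutativeRing = record { isCommutativeRing = isCommutativeRing }

  open CommutativeRing commutativeRing using (semiring; ring; +-group)
  open CommutativeRing commutativeRing public
    using ( +-assoc; +-comm; *-assoc; *-comm; +-identityˡ; +-identityʳ; *-identityˡ; *-identityʳ
          ; -‿inverseˡ; -‿inverseʳ; distribʳ; zeroˡ; zeroʳ )
  open import Algebra.Properties.Semiring.Exp semiring public using (_^_)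
  open import Algebra.Properties.Ring ring public using (-‿distribˡ-*; -‿distribʳ-*)
  open import Algebra.Properties.Group +-group public
    using (⁻¹-involutive; ⁻¹-anti-homo-∙; x∙y⁻¹≈ε⇒x≈y) renaming (ε⁻¹≈ε to -0#≡0#)

  -- 1 is special-cased so that # 1 is 1# on the nose, as the solver's constant 1 requires.
  infix 25 #_
  #_ : ℕ → Carrier
  # zero = 0#
  # suc zero = 1#
  # suc (suc n) = 1# + # suc n

  #-suc : ∀ n → # suc n ≡ 1# + # n
  #-suc zero    = sym (+-identityʳ 1#)
  #-suc (suc n) = refl

  #-+ : ∀ m n → # (m ℕ.+ n) ≡ # m + # n
  #-+ zero    n = sym (+-identityˡ _)
  #-+ (suc m) n = begin
    # suc (m ℕ.+ n)        ≡⟨ #-suc (m ℕ.+ n) ⟩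
    1# + # (m ℕ.+ n)       ≡⟨ cong (1# +_) (#-+ m n) ⟩
    1# + (# m + # n)       ≡⟨ sym (+-assoc _ _ _) ⟩
    (1# + # m) + # n       ≡⟨ cong (_+ # n) (sym (#-suc m)) ⟩
    # suc m + # n          ∎
    where open ≡-Reasoning

  #-* : ∀ m n → # (m ℕ.* n) ≡ # m * # n
  #-* zero    n = sym (zeroˡ _)
  #-* (suc m) n = begin
    # (n ℕ.+ m ℕ.* n)      ≡⟨ #-+ n (m ℕ.* n) ⟩
    # n + # (m ℕ.* n)      ≡⟨ cong₂ _+_ (sym (*-identityˡ _)) (#-* m n) ⟩
    1# * # n + # m * # n   ≡⟨ sym (distribʳ _ _ _) ⟩
    (1# + # m) * # n       ≡⟨ cong (_* # n) (sym (#-suc m)) ⟩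
    # suc m * # n          ∎
    where open ≡-Reasoning

  #-^ : ∀ m n → # (m ℕ.^ n) ≡ # m ^ n
  #-^ m zero    = refl
  #-^ m (suc n) = trans (#-* m (m ℕ.^ n)) (cong (# m *_) (#-^ m n))

  -- The ring solver works with integer coefficients, interpreted through ℤ → F.
  ⟦_⟧ℤ : ℤ → Carrier
  ⟦ pos n ⟧ℤ = # n
  ⟦ -[1+ n ] ⟧ℤ = - # suc n

  x+y-[x+z]≡y-z : ∀ x y z → (x + y) - (x + z) ≡ y - z
  x+y-[x+z]≡y-z x y z = begin
    (x + y) + - (x + z)     ≡⟨ cong ((x + y) +_) (⁻¹-anti-homo-∙ x z) ⟩
    (x + y) + (- z + - x)   ≡⟨ cong ((x + y) +_) (+-comm (- z) (- x)) ⟩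
    (x + y) + (- x + - z)   ≡⟨ +-assoc x y _ ⟩
    x + (y + (- x + - z))   ≡⟨ cong (x +_) (trans (sym (+-assoc y (- x) (- z))) (cong (_+ - z) (+-comm y (- x)))) ⟩
    x + ((- x + y) + - z)   ≡⟨ cong (x +_) (+-assoc (- x) y (- z)) ⟩
    x + (- x + (y + - z))   ≡⟨ sym (+-assoc x (- x) _) ⟩
    (x + - x) + (y + - z)   ≡⟨ cong (_+ (y - z)) (-‿inverseʳ x) ⟩
    0# + (y + - z)          ≡⟨ +-identityˡ _ ⟩
    y - z                   ∎
    where open ≡-Reasoning

  ⟦⊖⟧ : ∀ m n → ⟦ m ⊖ n ⟧ℤ ≡ # m - # n
  ⟦⊖⟧ zero    zero    = sym (trans (cong (0# +_) -0#≡0#) (+-identityʳ 0#))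
  ⟦⊖⟧ zero    (suc n) = sym (+-identityˡ _)
  ⟦⊖⟧ (suc m) zero    = sym (trans (cong (# suc m +_) -0#≡0#) (+-identityʳ _))
  ⟦⊖⟧ (suc m) (suc n) = begin
    ⟦ suc m ⊖ suc n ⟧ℤ     ≡⟨ cong ⟦_⟧ℤ (ℤ.[1+m]⊖[1+n]≡m⊖n m n) ⟩
    ⟦ m ⊖ n ⟧ℤ             ≡⟨ ⟦⊖⟧ m n ⟩
    # m - # n              ≡⟨ sym (x+y-[x+z]≡y-z 1# (# m) (# n)) ⟩
    (1# + # m) - (1# + # n) ≡⟨ sym (cong₂ _-_ (#-suc m) (#-suc n)) ⟩
    # suc m - # suc n      ∎
    where open ≡-Reasoning

  ⟦-⟧ : ∀ i → ⟦ ℤ.- i ⟧ℤ ≡ - ⟦ i ⟧ℤ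
  ⟦-⟧ (pos zero)    = sym -0#≡0#
  ⟦-⟧ (pos (suc n)) = refl
  ⟦-⟧ -[1+ n ]      = sym (⁻¹-involutive _)

  ⟦+⟧ : ∀ i j → ⟦ i ℤ.+ j ⟧ℤ ≡ ⟦ i ⟧ℤ + ⟦ j ⟧ℤ
  ⟦+⟧ (pos m)  (pos n)  = #-+ m n
  ⟦+⟧ (pos m)  -[1+ n ] = ⟦⊖⟧ m (suc n)
  ⟦+⟧ -[1+ m ] (pos n)  = trans (⟦⊖⟧ n (suc m)) (+-comm _ _)
  ⟦+⟧ -[1+ m ] -[1+ n ] = begin
    - # suc (suc (m ℕ.+ n))       ≡⟨ cong (λ k → - # k) (sym (ℕ.+-suc (suc m) n)) ⟩
    - # (suc m ℕ.+ suc n)         ≡⟨ cong -_ (#-+ (suc m) (suc n)) ⟩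
    - (# suc m + # suc n)         ≡⟨ ⁻¹-anti-homo-∙ _ _ ⟩
    - # suc n + - # suc m         ≡⟨ +-comm _ _ ⟩
    - # suc m + - # suc n         ∎
    where open ≡-Reasoning

  ⟦pos*⟧ : ∀ m j → ⟦ pos m ℤ.* j ⟧ℤ ≡ # m * ⟦ j ⟧ℤ
  ⟦pos*⟧ m (pos n)  = trans (cong ⟦_⟧ℤ (sym (ℤ.pos-* m n))) (#-* m n)
  ⟦pos*⟧ m -[1+ n ] = begin
    ⟦ pos m ℤ.* -[1+ n ] ⟧ℤ            ≡⟨ cong ⟦_⟧ℤ (sym (ℤ.neg-distribʳ-* (pos m) (pos (suc n)))) ⟩
    ⟦ ℤ.- (pos m ℤ.* pos (suc n)) ⟧ℤ   ≡⟨ ⟦-⟧ (pos m ℤ.* pos (suc n)) ⟩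
    - ⟦ pos m ℤ.* pos (suc n) ⟧ℤ       ≡⟨ cong -_ (⟦pos*⟧ m (pos (suc n))) ⟩
    - (# m * # suc n)                  ≡⟨ -‿distribʳ-* _ _ ⟩
    # m * - # suc n                    ∎
    where open ≡-Reasoning

  ⟦*⟧ : ∀ i j → ⟦ i ℤ.* j ⟧ℤ ≡ ⟦ i ⟧ℤ * ⟦ j ⟧ℤ
  ⟦*⟧ (pos m)  j = ⟦pos*⟧ m j
  ⟦*⟧ -[1+ m ] j = begin
    ⟦ -[1+ m ] ℤ.* j ⟧ℤ            ≡⟨ cong ⟦_⟧ℤ (sym (ℤ.neg-distribˡ-* (pos (suc m)) j)) ⟩
    ⟦ ℤ.- (pos (suc m) ℤ.* j) ⟧ℤ   ≡⟨ ⟦-⟧ (pos (suc m) ℤ.* j) ⟩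
    - ⟦ pos (suc m) ℤ.* j ⟧ℤ       ≡⟨ cong -_ (⟦pos*⟧ (suc m) j) ⟩
    - (# suc m * ⟦ j ⟧ℤ)           ≡⟨ -‿distribˡ-* _ _ ⟩
    - # suc m * ⟦ j ⟧ℤ             ∎
    where open ≡-Reasoning

  almostCommutativeRing : AlmostCommutativeRing _ _
  almostCommutativeRing = fromCommutativeRing commutativeRing

  ℤ⟶F : ℤ.+-*-rawRing -Raw-AlmostCommutative⟶ almostCommutativeRing
  ℤ⟶F = record
    { ⟦_⟧ = ⟦_⟧ℤ ; +-homo = ⟦+⟧ ; *-homo = ⟦*⟧ ; -‿homo = ⟦-⟧ ; 0-homo = refl ; 1-homo = refl }

  ⟦≟⟧ : ∀ i j → Maybe (⟦ i ⟧ℤ ≡ ⟦ j ⟧ℤ)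
  ⟦≟⟧ i j with i ℤ.≟ j
  ... | yes refl = just refl
  ... | no _     = nothing

  open import Algebra.Solver.Ring ℤ.+-*-rawRing almostCommutativeRing ℤ⟶F ⟦≟⟧ public
    using (solve; _:+_; _:*_; _:-_; :-_; _:=_; con)

  x-y≡0⇒x≡y : ∀ {x y} → x - y ≡ 0# → x ≡ y
  x-y≡0⇒x≡y = x∙y⁻¹≈ε⇒x≈y _ _

  1≢0 : ¬ (1# ≡ 0#)
  1≢0 e = 0≢1 (sym e)

  x⁻¹*x≡1 : ∀ {x} → ¬ (x ≡ 0#) → x ⁻¹ * x ≡ 1#
  x⁻¹*x≡1 {x} x≢0 = trans (*-comm _ _) (*-inverse x x≢0)

  x*y≡0⇒y≡0 : ∀ {x y} → ¬ (x ≡ 0#) → x * y ≡ 0# → y ≡ 0#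
  x*y≡0⇒y≡0 {x} {y} x≢0 xy≡0 = begin
    y                  ≡⟨ sym (*-identityˡ y) ⟩
    1# * y             ≡⟨ cong (_* y) (sym (x⁻¹*x≡1 x≢0)) ⟩
    (x ⁻¹ * x) * y     ≡⟨ *-assoc _ _ _ ⟩
    x ⁻¹ * (x * y)     ≡⟨ cong (x ⁻¹ *_) xy≡0 ⟩
    x ⁻¹ * 0#          ≡⟨ zeroʳ _ ⟩
    0#                 ∎
    where open ≡-Reasoning

  x*y≢0 : ∀ {x y} → ¬ (x ≡ 0#) → ¬ (y ≡ 0#) → ¬ (x * y ≡ 0#)
  x*y≢0 x≢0 y≢0 xy≡0 = y≢0 (x*y≡0⇒y≡0 x≢0 xy≡0)

  x^n≢0 : ∀ {x} n → ¬ (x ≡ 0#) → ¬ (x ^ n ≡ 0#)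
  x^n≢0 zero    x≢0 = 1≢0
  x^n≢0 (suc n) x≢0 = x*y≢0 x≢0 (x^n≢0 n x≢0)

  -x≢0 : ∀ {x} → ¬ (x ≡ 0#) → ¬ (- x ≡ 0#)
  -x≢0 {x} x≢0 -x≡0 = x≢0 (trans (sym (⁻¹-involutive x)) (trans (cong -_ -x≡0) -0#≡0#))

  ⁻¹-injective : ∀ {x y} → ¬ (x ≡ 0#) → ¬ (y ≡ 0#) → x ⁻¹ ≡ y ⁻¹ → x ≡ y
  ⁻¹-injective {x} {y} x≢0 y≢0 e = begin
    x                ≡⟨ sym (*-identityʳ x) ⟩
    x * 1#           ≡⟨ cong (x *_) (sym (x⁻¹*x≡1 y≢0)) ⟩
    x * (y ⁻¹ * y)   ≡⟨ cong (λ z → x * (z * y)) (sym e) ⟩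
    x * (x ⁻¹ * y)   ≡⟨ sym (*-assoc _ _ _) ⟩
    (x * x ⁻¹) * y   ≡⟨ cong (_* y) (*-inverse x x≢0) ⟩
    1# * y           ≡⟨ *-identityˡ y ⟩
    y                ∎
    where open ≡-Reasoning

module PowerSeries (F : Field) where
  open Field F
  open FieldProperties F

  Series : Set
  Series = ℕ → Carrier

  open Setoid (ℕ →-setoid Carrier) public using () renaming (refl to ≗-refl; sym to ≗-sym; trans to ≗-trans)
  module ≗-Reasoning = SetoidReasoning (ℕ →-setoid Carrier)

  1ₛ : Series
  1ₛ zero    = 1#
  1ₛ (suc j) = 0#

  infixl 6 _+ₛ_
  infixr 7 _·ₛ_

  _+ₛ_ : Series → Series → Series
  (f +ₛ g) j = f j + g j

  _·ₛ_ : Carrier → Series → Series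
  (c ·ₛ f) j = c * f j

  z·_ : Series → Series
  (z· f) zero    = 0#
  (z· f) (suc j) = f j

  +ₛ-cong : ∀ {f f′ g g′} → f ≗ f′ → g ≗ g′ → f +ₛ g ≗ f′ +ₛ g′
  +ₛ-cong f≗f′ g≗g′ j = cong₂ _+_ (f≗f′ j) (g≗g′ j)

  +ₛ-assoc : ∀ f g h → (f +ₛ g) +ₛ h ≗ f +ₛ (g +ₛ h)
  +ₛ-assoc f g h j = +-assoc (f j) (g j) (h j)

  mul1-xz : Carrier → Series → Series
  mul1-xz x f zero    = f zero
  mul1-xz x f (suc j) = f (suc j) - x * f j

  mulΠ1-xz : List Carrier → Series → Series
  mulΠ1-xz L f = foldr mul1-xz f L

  mulΠ1-xz-++ : ∀ L M f → mulΠ1-xz (L ++ M) f ≡ mulΠ1-xz L (mulΠ1-xz M f)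
  mulΠ1-xz-++ L M f = foldr-++ mul1-xz f L M

  mul1-xz-cong : ∀ x {f g} → f ≗ g → mul1-xz x f ≗ mul1-xz x g
  mul1-xz-cong x f≗g zero    = f≗g zero
  mul1-xz-cong x f≗g (suc j) = cong₂ (λ a b → a - x * b) (f≗g (suc j)) (f≗g j)

  mulΠ1-xz-cong : ∀ L {f g} → f ≗ g → mulΠ1-xz L f ≗ mulΠ1-xz L g
  mulΠ1-xz-cong []      f≗g = f≗g
  mulΠ1-xz-cong (x ∷ L) f≗g = mul1-xz-cong x (mulΠ1-xz-cong L f≗g)

  mul1-xz-comm : ∀ x y f → mul1-xz x (mul1-xz y f) ≗ mul1-xz y (mul1-xz x f)
  mul1-xz-comm x y f zero = refl
  mul1-xz-comm x y f (suc zero) =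
    solve 4 (λ x y a b → (a :- y :* b) :- x :* b := (a :- x :* b) :- y :* b) refl x y (f 1) (f 0)
  mul1-xz-comm x y f (suc (suc j)) =
    solve 5 (λ x y a b c → (a :- y :* b) :- x :* (b :- y :* c) := (a :- x :* b) :- y :* (b :- x :* c))
      refl x y (f (suc (suc j))) (f (suc j)) (f j)

  mulΠ1-xz-mul1-xz : ∀ L x f → mulΠ1-xz L (mul1-xz x f) ≗ mul1-xz x (mulΠ1-xz L f)
  mulΠ1-xz-mul1-xz []      x f = ≗-refl
  mulΠ1-xz-mul1-xz (y ∷ L) x f =
    ≗-trans (mul1-xz-cong y (mulΠ1-xz-mul1-xz L x f)) (mul1-xz-comm y x (mulΠ1-xz L f))

  mulΠ1-xz-↭ : ∀ {L M} f → L ↭ M → mulΠ1-xz L f ≗ mulΠ1-xz M f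
  mulΠ1-xz-↭ f ↭.refl           = ≗-refl
  mulΠ1-xz-↭ f (↭.prep x L↭M)   = mul1-xz-cong x (mulΠ1-xz-↭ f L↭M)
  mulΠ1-xz-↭ f (↭.swap x y L↭M) =
    ≗-trans (mul1-xz-comm x y _) (mul1-xz-cong y (mul1-xz-cong x (mulΠ1-xz-↭ f L↭M)))
  mulΠ1-xz-↭ f (↭.trans L↭M M↭N) = ≗-trans (mulΠ1-xz-↭ f L↭M) (mulΠ1-xz-↭ f M↭N)

  mul1-xz-+ₛ : ∀ x f g → mul1-xz x (f +ₛ g) ≗ mul1-xz x f +ₛ mul1-xz x g
  mul1-xz-+ₛ x f g zero    = refl
  mul1-xz-+ₛ x f g (suc j) =
    solve 5 (λ x a b c d → (a :+ b) :- x :* (c :+ d) := (a :- x :* c) :+ (b :- x :* d))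
      refl x (f (suc j)) (g (suc j)) (f j) (g j)

  mul1-xz-·ₛ : ∀ x c f → mul1-xz x (c ·ₛ f) ≗ c ·ₛ mul1-xz x f
  mul1-xz-·ₛ x c f zero    = refl
  mul1-xz-·ₛ x c f (suc j) =
    solve 4 (λ x c a b → c :* a :- x :* (c :* b) := c :* (a :- x :* b)) refl x c (f (suc j)) (f j)

  mul1-xz-z· : ∀ x f → mul1-xz x (z· f) ≗ z· mul1-xz x f
  mul1-xz-z· x f zero          = refl
  mul1-xz-z· x f (suc zero)    = solve 2 (λ x a → a :- x :* con (pos 0) := a) refl x (f 0)
  mul1-xz-z· x f (suc (suc j)) = refl

  mulΠ1-xz-+ₛ : ∀ L f g → mulΠ1-xz L (f +ₛ g) ≗ mulΠ1-xz L f +ₛ mulΠ1-xz L g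
  mulΠ1-xz-+ₛ []      f g = ≗-refl
  mulΠ1-xz-+ₛ (x ∷ L) f g = ≗-trans (mul1-xz-cong x (mulΠ1-xz-+ₛ L f g)) (mul1-xz-+ₛ x _ _)

  mulΠ1-xz-·ₛ : ∀ L c f → mulΠ1-xz L (c ·ₛ f) ≗ c ·ₛ mulΠ1-xz L f
  mulΠ1-xz-·ₛ []      c f = ≗-refl
  mulΠ1-xz-·ₛ (x ∷ L) c f = ≗-trans (mul1-xz-cong x (mulΠ1-xz-·ₛ L c f)) (mul1-xz-·ₛ x c _)

  mulΠ1-xz-z· : ∀ L f → mulΠ1-xz L (z· f) ≗ z· mulΠ1-xz L f
  mulΠ1-xz-z· []      f = ≗-refl
  mulΠ1-xz-z· (x ∷ L) f = ≗-trans (mul1-xz-cong x (mulΠ1-xz-z· L f)) (mul1-xz-z· x _)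

  -- Coefficient i of invΠ1-xz L is the complete homogeneous symmetric polynomial h_i(L).
  invΠ1-xz : List Carrier → Series
  invΠ1-xz []      zero    = 1#
  invΠ1-xz []      (suc i) = 0#
  invΠ1-xz (x ∷ L) zero    = 1#
  invΠ1-xz (x ∷ L) (suc i) = invΠ1-xz L (suc i) + x * invΠ1-xz (x ∷ L) i

  invΠ1-xz-0 : ∀ L → invΠ1-xz L 0 ≡ 1#
  invΠ1-xz-0 []      = refl
  invΠ1-xz-0 (x ∷ L) = refl

  mulΠ1-xz-invΠ1-xz : ∀ L → mulΠ1-xz L (invΠ1-xz L) ≗ 1ₛ
  mulΠ1-xz-invΠ1-xz []      zero    = refl
  mulΠ1-xz-invΠ1-xz []      (suc j) = refl
  mulΠ1-xz-invΠ1-xz (x ∷ L) = begin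
    mul1-xz x (mulΠ1-xz L (invΠ1-xz (x ∷ L)))   ≈⟨ mulΠ1-xz-mul1-xz L x _ ⟨
    mulΠ1-xz L (mul1-xz x (invΠ1-xz (x ∷ L)))   ≈⟨ mulΠ1-xz-cong L mul1-xz-inv ⟩
    mulΠ1-xz L (invΠ1-xz L)                     ≈⟨ mulΠ1-xz-invΠ1-xz L ⟩
    1ₛ                                          ∎
    where
    open ≗-Reasoning
    mul1-xz-inv : mul1-xz x (invΠ1-xz (x ∷ L)) ≗ invΠ1-xz L
    mul1-xz-inv zero    = sym (invΠ1-xz-0 L)
    mul1-xz-inv (suc i) =
      solve 3 (λ a x b → (a :+ x :* b) :- x :* b := a) refl (invΠ1-xz L (suc i)) x (invΠ1-xz (x ∷ L) i)

  DegreeBelow : ℕ → Series → Set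
  DegreeBelow t f = ∀ j → t ≤ j → f j ≡ 0#

  OrderAtLeast : ℕ → Series → Set
  OrderAtLeast s f = ∀ j → j < s → f j ≡ 0#

  DegreeBelow-mono : ∀ {t t′} f → t ≤ t′ → DegreeBelow t f → DegreeBelow t′ f
  DegreeBelow-mono f t≤t′ deg j t′≤j = deg j (ℕ.≤-trans t≤t′ t′≤j)

  1ₛ-degree : DegreeBelow 1 1ₛ
  1ₛ-degree (suc j) _ = refl

  0-x*0≡0 : ∀ x → 0# - x * 0# ≡ 0#
  0-x*0≡0 x = solve 1 (λ x → con (pos 0) :- x :* con (pos 0) := con (pos 0)) refl x

  0+-x*0≡0 : ∀ x → 0# + - x * 0# ≡ 0#
  0+-x*0≡0 x = solve 1 (λ x → con (pos 0) :+ (:- x) :* con (pos 0) := con (pos 0)) refl x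

  mul1-xz-degree : ∀ x {t} f → DegreeBelow t f → DegreeBelow (suc t) (mul1-xz x f)
  mul1-xz-degree x f deg (suc j) (s≤s t≤j) =
    trans (cong₂ (λ a b → a - x * b) (deg (suc j) (ℕ.m≤n⇒m≤1+n t≤j)) (deg j t≤j)) (0-x*0≡0 x)

  mulΠ1-xz-degree : ∀ L {t} f → DegreeBelow t f → DegreeBelow (length L ℕ.+ t) (mulΠ1-xz L f)
  mulΠ1-xz-degree []      f deg = deg
  mulΠ1-xz-degree (x ∷ L) f deg = mul1-xz-degree x _ (mulΠ1-xz-degree L f deg)

  mul1-xz-order : ∀ x {s} f → OrderAtLeast s f → OrderAtLeast s (mul1-xz x f)
  mul1-xz-order x f ord zero    0<s = ord zero 0<s
  mul1-xz-order x f ord (suc j) j<s =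
    trans (cong₂ (λ a b → a - x * b) (ord (suc j) j<s) (ord j (ℕ.<-trans (ℕ.n<1+n j) j<s))) (0-x*0≡0 x)

  mul1-xz-lowest : ∀ x {s} f → OrderAtLeast s f → mul1-xz x f s ≡ f s
  mul1-xz-lowest x {zero}  f ord = refl
  mul1-xz-lowest x {suc s} f ord =
    trans (cong (λ b → f (suc s) - x * b) (ord s (ℕ.n<1+n s)))
          (solve 2 (λ a x → a :- x :* con (pos 0) := a) refl (f (suc s)) x)

  mulΠ1-xz-order : ∀ L {s} f → OrderAtLeast s f → OrderAtLeast s (mulΠ1-xz L f)
  mulΠ1-xz-order []      f ord = ord
  mulΠ1-xz-order (x ∷ L) f ord = mul1-xz-order x _ (mulΠ1-xz-order L f ord)

  mulΠ1-xz-lowest : ∀ L {s} f → OrderAtLeast s f → mulΠ1-xz L f s ≡ f s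
  mulΠ1-xz-lowest []      f ord = refl
  mulΠ1-xz-lowest (x ∷ L) f ord =
    trans (mul1-xz-lowest x _ (mulΠ1-xz-order L f ord)) (mulΠ1-xz-lowest L f ord)

  Π-x : List Carrier → Carrier
  Π-x []      = 1#
  Π-x (x ∷ L) = (- x) * Π-x L

  Π-x-≢0 : ∀ L → All (λ x → ¬ (x ≡ 0#)) L → ¬ (Π-x L ≡ 0#)
  Π-x-≢0 []      []          = 1≢0
  Π-x-≢0 (x ∷ L) (x≢0 ∷ L≢0) = x*y≢0 (-x≢0 x≢0) (Π-x-≢0 L L≢0)

  mulΠ1-xz-top : ∀ L s f → DegreeBelow (suc s) f → mulΠ1-xz L f (length L ℕ.+ s) ≡ f s * Π-x L
  mulΠ1-xz-top []      s f deg = sym (*-identityʳ _)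
  mulΠ1-xz-top (x ∷ L) s f deg = begin
    mulΠ1-xz L f (suc (length L ℕ.+ s)) - x * mulΠ1-xz L f (length L ℕ.+ s)
      ≡⟨ cong₂ (λ a b → a - x * b) (mulΠ1-xz-degree L f deg _ (ℕ.≤-reflexive (ℕ.+-suc (length L) s)))
                                   (mulΠ1-xz-top L s f deg) ⟩
    0# - x * (f s * Π-x L)
      ≡⟨ solve 3 (λ x a b → con (pos 0) :- x :* (a :* b) := a :* ((:- x) :* b)) refl x (f s) (Π-x L) ⟩
    f s * ((- x) * Π-x L)
      ∎
    where open ≡-Reasoning

  dilate : Carrier → Series → Series
  dilate c f j = c ^ j * f j

  mul1-xz-dilate : ∀ c x f → mul1-xz (c * x) (dilate c f) ≗ dilate c (mul1-xz x f)
  mul1-xz-dilate c x f zero    = refl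
  mul1-xz-dilate c x f (suc j) =
    solve 5 (λ c p x a b → c :* p :* a :- c :* x :* (p :* b) := c :* p :* (a :- x :* b))
      refl c (c ^ j) x (f (suc j)) (f j)

  mulΠ1-xz-dilate : ∀ c L f → mulΠ1-xz (map (c *_) L) (dilate c f) ≗ dilate c (mulΠ1-xz L f)
  mulΠ1-xz-dilate c []      f = ≗-refl
  mulΠ1-xz-dilate c (x ∷ L) f = ≗-trans (mul1-xz-cong (c * x) (mulΠ1-xz-dilate c L f)) (mul1-xz-dilate c x _)

  dilate-1ₛ : ∀ c → dilate c 1ₛ ≗ 1ₛ
  dilate-1ₛ c zero    = *-identityʳ _
  dilate-1ₛ c (suc j) = zeroʳ _

  deriv : Series → Series
  deriv f j = # suc j * f (suc j)

  deriv-mul1-xz : ∀ x f → deriv (mul1-xz x f) ≗ mul1-xz x (deriv f) +ₛ (- x) ·ₛ f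
  deriv-mul1-xz x f zero    =
    solve 3 (λ a x b → con (pos 1) :* (a :- x :* b) := con (pos 1) :* a :+ (:- x) :* b) refl (f 1) x (f 0)
  deriv-mul1-xz x f (suc j) =
    solve 4 (λ n a x b → (con (pos 1) :+ n) :* (a :- x :* b) := ((con (pos 1) :+ n) :* a :- x :* (n :* b)) :+ (:- x) :* b)
      refl (# suc j) (f (suc (suc j))) x (f (suc j))

  -- derivΠ1-xz L f is (∏_{x ∈ L} (1 - x z))′ · f.
  derivΠ1-xz : List Carrier → Series → Series
  derivΠ1-xz []      f _ = 0#
  derivΠ1-xz (x ∷ L) f   = mul1-xz x (derivΠ1-xz L f) +ₛ (- x) ·ₛ mulΠ1-xz L f

  deriv-mulΠ1-xz : ∀ L f → deriv (mulΠ1-xz L f) ≗ mulΠ1-xz L (deriv f) +ₛ derivΠ1-xz L f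
  deriv-mulΠ1-xz []      f j = sym (+-identityʳ _)
  deriv-mulΠ1-xz (x ∷ L) f = begin
    deriv (mul1-xz x (mulΠ1-xz L f))
      ≈⟨ deriv-mul1-xz x (mulΠ1-xz L f) ⟩
    mul1-xz x (deriv (mulΠ1-xz L f)) +ₛ (- x) ·ₛ mulΠ1-xz L f
      ≈⟨ +ₛ-cong (mul1-xz-cong x (deriv-mulΠ1-xz L f)) ≗-refl ⟩
    mul1-xz x (mulΠ1-xz L (deriv f) +ₛ derivΠ1-xz L f) +ₛ (- x) ·ₛ mulΠ1-xz L f
      ≈⟨ +ₛ-cong (mul1-xz-+ₛ x _ _) ≗-refl ⟩
    (mul1-xz x (mulΠ1-xz L (deriv f)) +ₛ mul1-xz x (derivΠ1-xz L f)) +ₛ (- x) ·ₛ mulΠ1-xz L f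
      ≈⟨ +ₛ-assoc _ _ _ ⟩
    mulΠ1-xz (x ∷ L) (deriv f) +ₛ derivΠ1-xz (x ∷ L) f
      ∎
    where open ≗-Reasoning

  mul1-xz-0 : ∀ x → mul1-xz x (λ _ → 0#) ≗ (λ _ → 0#)
  mul1-xz-0 x zero    = refl
  mul1-xz-0 x (suc j) = 0-x*0≡0 x

  derivΠ1-xz-mul1-xz : ∀ L y f → derivΠ1-xz L (mul1-xz y f) ≗ mul1-xz y (derivΠ1-xz L f)
  derivΠ1-xz-mul1-xz []      y f = ≗-sym (mul1-xz-0 y)
  derivΠ1-xz-mul1-xz (x ∷ L) y f = begin
    mul1-xz x (derivΠ1-xz L (mul1-xz y f)) +ₛ (- x) ·ₛ mulΠ1-xz L (mul1-xz y f)
      ≈⟨ +ₛ-cong (mul1-xz-cong x (derivΠ1-xz-mul1-xz L y f)) (λ j → cong ((- x) *_) (mulΠ1-xz-mul1-xz L y f j)) ⟩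
    mul1-xz x (mul1-xz y (derivΠ1-xz L f)) +ₛ (- x) ·ₛ mul1-xz y (mulΠ1-xz L f)
      ≈⟨ +ₛ-cong (mul1-xz-comm x y _) (≗-sym (mul1-xz-·ₛ y (- x) _)) ⟩
    mul1-xz y (mul1-xz x (derivΠ1-xz L f)) +ₛ mul1-xz y ((- x) ·ₛ mulΠ1-xz L f)
      ≈⟨ mul1-xz-+ₛ y _ _ ⟨
    mul1-xz y (derivΠ1-xz (x ∷ L) f)
      ∎
    where open ≗-Reasoning

  derivΠ1-xz-mulΠ1-xz : ∀ L M f → derivΠ1-xz L (mulΠ1-xz M f) ≗ mulΠ1-xz M (derivΠ1-xz L f)
  derivΠ1-xz-mulΠ1-xz L []      f = ≗-refl
  derivΠ1-xz-mulΠ1-xz L (y ∷ M) f =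
    ≗-trans (derivΠ1-xz-mul1-xz L y (mulΠ1-xz M f)) (mul1-xz-cong y (derivΠ1-xz-mulΠ1-xz L M f))

  derivΠ1-xz-++ : ∀ L M f → derivΠ1-xz (L ++ M) f ≗ mulΠ1-xz L (derivΠ1-xz M f) +ₛ derivΠ1-xz L (mulΠ1-xz M f)
  derivΠ1-xz-++ []      M f j = sym (+-identityʳ _)
  derivΠ1-xz-++ (x ∷ L) M f = begin
    mul1-xz x (derivΠ1-xz (L ++ M) f) +ₛ (- x) ·ₛ mulΠ1-xz (L ++ M) f
      ≈⟨ +ₛ-cong (mul1-xz-cong x (derivΠ1-xz-++ L M f)) (λ j → cong (λ g → - x * g j) (mulΠ1-xz-++ L M f)) ⟩
    mul1-xz x (mulΠ1-xz L (derivΠ1-xz M f) +ₛ derivΠ1-xz L (mulΠ1-xz M f)) +ₛ (- x) ·ₛ mulΠ1-xz L (mulΠ1-xz M f)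
      ≈⟨ +ₛ-cong (mul1-xz-+ₛ x _ _) ≗-refl ⟩
    (mulΠ1-xz (x ∷ L) (derivΠ1-xz M f) +ₛ mul1-xz x (derivΠ1-xz L (mulΠ1-xz M f))) +ₛ (- x) ·ₛ mulΠ1-xz L (mulΠ1-xz M f)
      ≈⟨ +ₛ-assoc _ _ _ ⟩
    mulΠ1-xz (x ∷ L) (derivΠ1-xz M f) +ₛ derivΠ1-xz (x ∷ L) (mulΠ1-xz M f)
      ∎
    where open ≗-Reasoning

  derivΠ1-xz-power : ∀ m B f →
    derivΠ1-xz (concat (replicate (suc m) B)) f ≗ # suc m ·ₛ mulΠ1-xz (concat (replicate m B)) (derivΠ1-xz B f)
  derivΠ1-xz-power zero    B f j = trans (cong (λ L → derivΠ1-xz L f j) (++-identityʳ B)) (sym (*-identityˡ _))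
  derivΠ1-xz-power (suc m) B f = begin
    derivΠ1-xz (B ++ Bᵐ⁺¹) f
      ≈⟨ derivΠ1-xz-++ B Bᵐ⁺¹ f ⟩
    mulΠ1-xz B (derivΠ1-xz Bᵐ⁺¹ f) +ₛ derivΠ1-xz B (mulΠ1-xz Bᵐ⁺¹ f)
      ≈⟨ +ₛ-cong (mulΠ1-xz-cong B (derivΠ1-xz-power m B f)) (derivΠ1-xz-mulΠ1-xz B Bᵐ⁺¹ f) ⟩
    mulΠ1-xz B (# suc m ·ₛ mulΠ1-xz Bᵐ (derivΠ1-xz B f)) +ₛ mulΠ1-xz Bᵐ⁺¹ (derivΠ1-xz B f)
      ≈⟨ +ₛ-cong (mulΠ1-xz-·ₛ B _ _) ≗-refl ⟩
    # suc m ·ₛ mulΠ1-xz B (mulΠ1-xz Bᵐ (derivΠ1-xz B f)) +ₛ mulΠ1-xz Bᵐ⁺¹ (derivΠ1-xz B f)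
      ≈⟨ +ₛ-cong (λ j → cong (λ g → # suc m * g j) (sym (mulΠ1-xz-++ B Bᵐ (derivΠ1-xz B f)))) ≗-refl ⟩
    # suc m ·ₛ mulΠ1-xz Bᵐ⁺¹ (derivΠ1-xz B f) +ₛ mulΠ1-xz Bᵐ⁺¹ (derivΠ1-xz B f)
      ≈⟨ (λ j → solve 2 (λ n a → n :* a :+ a := (con (pos 1) :+ n) :* a) refl (# suc m) (mulΠ1-xz Bᵐ⁺¹ (derivΠ1-xz B f) j)) ⟩
    # suc (suc m) ·ₛ mulΠ1-xz Bᵐ⁺¹ (derivΠ1-xz B f)
      ∎
    where
    open ≗-Reasoning
    Bᵐ Bᵐ⁺¹ : List Carrier
    Bᵐ   = concat (replicate m B)
    Bᵐ⁺¹ = concat (replicate (suc m) B)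

  derivΠ1-xz-degree : ∀ L {t} f → DegreeBelow (suc t) f → DegreeBelow (length L ℕ.+ t) (derivΠ1-xz L f)
  derivΠ1-xz-degree []          f deg j _ = refl
  derivΠ1-xz-degree (x ∷ [])    f deg j t<j =
    trans (cong₂ (λ a b → a + - x * b) (mul1-xz-0 x j) (deg j t<j)) (0+-x*0≡0 x)
  derivΠ1-xz-degree (x ∷ y ∷ L) {t} f deg j L+t<j =
    trans (cong₂ (λ a b → a + - x * b) (mul1-xz-degree x _ (derivΠ1-xz-degree (y ∷ L) f deg) j L+t<j)
                                      (mulΠ1-xz-degree (y ∷ L) f deg j (ℕ.≤-trans (ℕ.≤-reflexive (ℕ.+-suc (length (y ∷ L)) t)) L+t<j)))
          (0+-x*0≡0 x)

  truncate : ℕ → Series → Series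
  truncate t f j with j ℕ.<? t
  ... | yes _ = f j
  ... | no  _ = 0#

  truncate-< : ∀ t f j → j < t → truncate t f j ≡ f j
  truncate-< t f j j<t with j ℕ.<? t
  ... | yes _   = refl
  ... | no  j≮t = ⊥-elim (j≮t j<t)

  truncate-degree : ∀ t f → DegreeBelow t (truncate t f)
  truncate-degree t f j t≤j with j ℕ.<? t
  ... | yes j<t = ⊥-elim (ℕ.<-irrefl refl (ℕ.<-≤-trans j<t t≤j))
  ... | no  _   = refl

  deriv-degree : ∀ {t} f → DegreeBelow (suc t) f → DegreeBelow t (deriv f)
  deriv-degree f deg j t≤j = trans (cong (# suc j *_) (deg (suc j) (s≤s t≤j))) (zeroʳ _)

  -- A product of factors 1 - x z has constant term 1, so it does not change the order of a series.
  mulΠ1-xz-order⁻ : ∀ L s f → OrderAtLeast s (mulΠ1-xz L f) → OrderAtLeast s f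
  mulΠ1-xz-order⁻ L (suc s) f ord j j<1+s with ℕ.m≤n⇒m<n∨m≡n (ℕ.≤-pred j<1+s)
  ... | inj₁ j<s  = mulΠ1-xz-order⁻ L s f (λ i i<s → ord i (ℕ.m≤n⇒m≤1+n i<s)) j j<s
  ... | inj₂ refl = trans (sym (mulΠ1-xz-lowest L f (mulΠ1-xz-order⁻ L j f (λ i i<j → ord i (ℕ.m≤n⇒m≤1+n i<j))))) (ord j j<1+s)

module PolynomialFunctions (F : Field) where
  open Field F
  open FieldProperties F
  open PowerSeries F using (invΠ1-xz)

  -- g agrees with a polynomial of degree ≤ i, witnessed in Horner form.
  PolyFun : ℕ → (Carrier → Carrier) → Set
  PolyFun zero    g = Σ Carrier λ c → ∀ y → g y ≡ c
  PolyFun (suc i) g = Σ Carrier λ c → Σ (Carrier → Carrier) λ h → PolyFun i h × (∀ y → g y ≡ c + y * h y)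

  PolyFun-cong : ∀ i {g g′} → (∀ y → g y ≡ g′ y) → PolyFun i g → PolyFun i g′
  PolyFun-cong zero    g≗g′ (c , g≡c)           = c , λ y → trans (sym (g≗g′ y)) (g≡c y)
  PolyFun-cong (suc i) g≗g′ (c , h , hᵢ , g≡c+yh) = c , h , hᵢ , λ y → trans (sym (g≗g′ y)) (g≡c+yh y)

  c+y*0≡c : ∀ c y → c + y * 0# ≡ c
  c+y*0≡c c y = trans (cong (c +_) (zeroʳ y)) (+-identityʳ c)

  PolyFun-const : ∀ i c → PolyFun i (λ _ → c)
  PolyFun-const zero    c = c , λ _ → refl
  PolyFun-const (suc i) c = c , (λ _ → 0#) , PolyFun-const i 0# , λ y → sym (c+y*0≡c c y)

  PolyFun-suc : ∀ i {g} → PolyFun i g → PolyFun (suc i) g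
  PolyFun-suc zero    (c , g≡c)           = c , (λ _ → 0#) , (0# , λ _ → refl) , λ y → trans (g≡c y) (sym (c+y*0≡c c y))
  PolyFun-suc (suc i) (c , h , hᵢ , g≡c+yh) = c , h , PolyFun-suc i hᵢ , g≡c+yh

  PolyFun-+ : ∀ i {g h} → PolyFun i g → PolyFun i h → PolyFun i (λ y → g y + h y)
  PolyFun-+ zero    (c , g≡c) (d , h≡d) = c + d , λ y → cong₂ _+_ (g≡c y) (h≡d y)
  PolyFun-+ (suc i) (c , g′ , g′ᵢ , g≡) (d , h′ , h′ᵢ , h≡) =
    c + d , (λ y → g′ y + h′ y) , PolyFun-+ i g′ᵢ h′ᵢ ,
    λ y → trans (cong₂ _+_ (g≡ y) (h≡ y))
                (solve 5 (λ c y a d b → (c :+ y :* a) :+ (d :+ y :* b) := (c :+ d) :+ y :* (a :+ b)) refl c y (g′ y) d (h′ y))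

  PolyFun-*ᶜ : ∀ i c {g} → PolyFun i g → PolyFun i (λ y → c * g y)
  PolyFun-*ᶜ zero    c (d , g≡d)            = c * d , λ y → cong (c *_) (g≡d y)
  PolyFun-*ᶜ (suc i) c (d , h , hᵢ , g≡d+yh) =
    c * d , (λ y → c * h y) , PolyFun-*ᶜ i c hᵢ ,
    λ y → trans (cong (c *_) (g≡d+yh y)) (solve 4 (λ c d y a → c :* (d :+ y :* a) := c :* d :+ y :* (c :* a)) refl c d y (h y))

  PolyFun-*linear : ∀ i β γ {g} → PolyFun i g → PolyFun (suc i) (λ y → (β + y * γ) * g y)
  PolyFun-*linear zero    β γ (c , g≡c) =
    β * c , (λ _ → γ * c) , (γ * c , λ _ → refl) ,
    λ y → trans (cong ((β + y * γ) *_) (g≡c y)) (solve 4 (λ b y g c → (b :+ y :* g) :* c := b :* c :+ y :* (g :* c)) refl β y γ c)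
  PolyFun-*linear (suc i) β γ (c , h , hᵢ , g≡c+yh) =
    β * c , (λ y → γ * c + (β + y * γ) * h y) , PolyFun-+ (suc i) (PolyFun-const (suc i) (γ * c)) (PolyFun-*linear i β γ hᵢ) ,
    λ y → trans (cong ((β + y * γ) *_) (g≡c+yh y))
                (solve 5 (λ b y g c a → (b :+ y :* g) :* (c :+ y :* a) := b :* c :+ y :* (g :* c :+ (b :+ y :* g) :* a)) refl β y γ c (h y))

  PolyFun-^ : ∀ j → PolyFun j (λ y → y ^ j)
  PolyFun-^ zero    = PolyFun-const 0 1#
  PolyFun-^ (suc j) = PolyFun-cong (suc j) (λ y → cong (_* y ^ j) (solve 1 (λ y → con (pos 0) :+ y :* con (pos 1) := y) refl y))
                                           (PolyFun-*linear j 0# 1# (PolyFun-^ j))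

  factor-theorem : ∀ i {g} → PolyFun (suc i) g → ∀ r →
    Σ (Carrier → Carrier) λ h → PolyFun i h × (∀ y → g y ≡ g r + (y - r) * h y)
  factor-theorem zero {g} (c , h , (d , h≡d) , g≡c+yh) r = h , (d , h≡d) , λ y → begin
    g y                            ≡⟨ g≡c+yh y ⟩
    c + y * h y                    ≡⟨ solve 4 (λ c y r a → c :+ y :* a := (c :+ r :* a) :+ (y :- r) :* a) refl c y r (h y) ⟩
    (c + r * h y) + (y - r) * h y  ≡⟨ cong (λ z → (c + r * z) + (y - r) * h y) (trans (h≡d y) (sym (h≡d r))) ⟩
    (c + r * h r) + (y - r) * h y  ≡⟨ cong (_+ (y - r) * h y) (sym (g≡c+yh r)) ⟩
    g r + (y - r) * h y            ∎
    where open ≡-Reasoning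
  factor-theorem (suc i) {g} (c , h , hᵢ , g≡c+yh) r with factor-theorem i hᵢ r
  ... | k , kᵢ , h≡ = (λ y → h y + r * k y) , PolyFun-+ (suc i) hᵢ (PolyFun-*ᶜ (suc i) r (PolyFun-suc i kᵢ)) , λ y → begin
    g y
      ≡⟨ g≡c+yh y ⟩
    c + y * h y
      ≡⟨ cong (λ z → c + y * z) (h≡ y) ⟩
    c + y * (h r + (y - r) * k y)
      ≡⟨ solve 5 (λ c y r a b → c :+ y :* (a :+ (y :- r) :* b) := (c :+ r :* a) :+ (y :- r) :* ((a :+ (y :- r) :* b) :+ r :* b)) refl c y r (h r) (k y) ⟩
    (c + r * h r) + (y - r) * ((h r + (y - r) * k y) + r * k y)
      ≡⟨ cong₂ (λ a b → a + (y - r) * (b + r * k y)) (sym (g≡c+yh r)) (sym (h≡ y)) ⟩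
    g r + (y - r) * (h y + r * k y)
      ∎
    where open ≡-Reasoning

  -- Nonvanishing at 0 is how "g is not the zero polynomial" is expressed.
  roots-length≤degree : ∀ i {g} → PolyFun i g → ¬ (g 0# ≡ 0#) →
    ∀ xs → Unique xs → All (λ x → g x ≡ 0#) xs → length xs ≤ i
  roots-length≤degree i       gᵢ g0≢0 []       _ _ = z≤n
  roots-length≤degree zero    (c , g≡c) g0≢0 (x ∷ xs) _ (gx≡0 ∷ _) = ⊥-elim (g0≢0 (trans (g≡c 0#) (trans (sym (g≡c x)) gx≡0)))
  roots-length≤degree (suc i) {g} gᵢ g0≢0 (x ∷ xs) (x∉xs ∷ xs!) (gx≡0 ∷ gxs≡0) with factor-theorem i gᵢ x
  ... | h , hᵢ , g≡ = s≤s (roots-length≤degree i hᵢ h0≢0 xs xs! (roots-of-h x∉xs gxs≡0))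
    where
    g≡[y-x]h : ∀ y → g y ≡ (y - x) * h y
    g≡[y-x]h y = trans (g≡ y) (trans (cong (_+ (y - x) * h y) gx≡0) (+-identityˡ _))
    h0≢0 : ¬ (h 0# ≡ 0#)
    h0≢0 h0≡0 = g0≢0 (trans (g≡[y-x]h 0#) (trans (cong ((0# - x) *_) h0≡0) (zeroʳ _)))
    roots-of-h : ∀ {ys} → All (λ y → ¬ (x ≡ y)) ys → All (λ y → g y ≡ 0#) ys → All (λ y → h y ≡ 0#) ys
    roots-of-h []             []            = []
    roots-of-h (x≢y ∷ x≢ys) (gy≡0 ∷ gys≡0) =
      x*y≡0⇒y≡0 (λ y-x≡0 → x≢y (sym (x-y≡0⇒x≡y y-x≡0))) (trans (sym (g≡[y-x]h _)) gy≡0) ∷ roots-of-h x≢ys gys≡0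

  invΠ1-xz-polyFun : ∀ {I : Set} (α β : I → Carrier) us i → PolyFun i (λ d → invΠ1-xz (map (λ u → β u - d * α u) us) i)
  invΠ1-xz-polyFun α β []       zero    = PolyFun-const 0 1#
  invΠ1-xz-polyFun α β []       (suc i) = PolyFun-const (suc i) 0#
  invΠ1-xz-polyFun α β (u ∷ us) zero    = PolyFun-const 0 1#
  invΠ1-xz-polyFun α β (u ∷ us) (suc i) = PolyFun-+ (suc i) (invΠ1-xz-polyFun α β us (suc i))
    (PolyFun-cong (suc i) (λ d → cong (_* invΠ1-xz (map (λ u → β u - d * α u) (u ∷ us)) i)
                                      (solve 3 (λ b d a → b :+ d :* (:- a) := b :- d :* a) refl (β u) d (α u)))
                  (PolyFun-*linear i (β u) (- α u) (invΠ1-xz-polyFun α β (u ∷ us) i)))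

module Evaluation (F : Field) where
  open Field F
  open FieldProperties F
  open PowerSeries F
  open PolynomialFunctions F

  eval : ℕ → Series → Carrier → Carrier
  eval zero    f y = 0#
  eval (suc N) f y = f 0 + y * eval N (λ j → f (suc j)) y

  eval-polyFun : ∀ N f → PolyFun N (eval (suc N) f)
  eval-polyFun zero    f = f 0 , λ y → c+y*0≡c (f 0) y
  eval-polyFun (suc N) f = f 0 , eval (suc N) (λ j → f (suc j)) , eval-polyFun N (λ j → f (suc j)) , λ y → refl

  eval-at-0 : ∀ N f → eval (suc N) f 0# ≡ f 0
  eval-at-0 N f = trans (cong (f 0 +_) (zeroˡ _)) (+-identityʳ _)

  eval-cong : ∀ N {f g} y → f ≗ g → eval N f y ≡ eval N g y
  eval-cong zero    y f≗g = refl
  eval-cong (suc N) y f≗g = cong₂ (λ a b → a + y * b) (f≗g 0) (eval-cong N y (λ j → f≗g (suc j)))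

  eval-0 : ∀ N f y → (∀ j → f j ≡ 0#) → eval N f y ≡ 0#
  eval-0 zero    f y f≡0 = refl
  eval-0 (suc N) f y f≡0 = trans (cong₂ (λ a b → a + y * b) (f≡0 0) (eval-0 N _ y (λ j → f≡0 (suc j)))) (c+y*0≡c 0# y)

  eval-degree : ∀ t N f y → DegreeBelow N f → eval (t ℕ.+ N) f y ≡ eval N f y
  eval-degree t zero    f y deg = trans (cong (λ M → eval M f y) (ℕ.+-identityʳ t)) (eval-0 t f y (λ j → deg j z≤n))
  eval-degree t (suc N) f y deg =
    trans (cong (λ M → eval M f y) (ℕ.+-suc t N))
          (cong (λ b → f 0 + y * b) (eval-degree t N (λ j → f (suc j)) y (λ j N≤j → deg (suc j) (s≤s N≤j))))

  eval-+ₛ : ∀ N f g y → eval N (f +ₛ g) y ≡ eval N f y + eval N g y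
  eval-+ₛ zero    f g y = sym (+-identityʳ _)
  eval-+ₛ (suc N) f g y =
    trans (cong (λ b → (f 0 + g 0) + y * b) (eval-+ₛ N _ _ y))
          (solve 5 (λ a b y c d → (a :+ b) :+ y :* (c :+ d) := (a :+ y :* c) :+ (b :+ y :* d)) refl (f 0) (g 0) y _ _)

  eval-·ₛ : ∀ N c f y → eval N (c ·ₛ f) y ≡ c * eval N f y
  eval-·ₛ zero    c f y = sym (zeroʳ _)
  eval-·ₛ (suc N) c f y =
    trans (cong (λ b → c * f 0 + y * b) (eval-·ₛ N c _ y))
          (solve 4 (λ c a y b → c :* a :+ y :* (c :* b) := c :* (a :+ y :* b)) refl c (f 0) y _)

  eval-mul1-xz : ∀ N x f y → DegreeBelow N f → eval (suc N) (mul1-xz x f) y ≡ (1# - x * y) * eval N f y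
  eval-mul1-xz N x f y deg = begin
    f 0 + y * eval N (λ j → f (suc j) - x * f j) y
      ≡⟨ cong (λ b → f 0 + y * b) (eval-cong N y λ j → cong (f (suc j) +_) (-‿distribˡ-* x (f j))) ⟩
    f 0 + y * eval N ((λ j → f (suc j)) +ₛ (- x) ·ₛ f) y
      ≡⟨ cong (λ b → f 0 + y * b) (eval-+ₛ N _ _ y) ⟩
    f 0 + y * (eval N (λ j → f (suc j)) y + eval N ((- x) ·ₛ f) y)
      ≡⟨ cong (λ b → f 0 + y * (eval N (λ j → f (suc j)) y + b)) (eval-·ₛ N (- x) f y) ⟩
    f 0 + y * (eval N (λ j → f (suc j)) y + - x * eval N f y)
      ≡⟨ solve 5 (λ a y b x c → a :+ y :* (b :+ (:- x) :* c) := (a :+ y :* b) :- x :* y :* c) refl (f 0) y _ x _ ⟩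
    eval (suc N) f y - x * y * eval N f y
      ≡⟨ cong (λ z → z - x * y * eval N f y) (eval-degree 1 N f y deg) ⟩
    eval N f y - x * y * eval N f y
      ≡⟨ solve 3 (λ a x y → a :- x :* y :* a := (con (pos 1) :- x :* y) :* a) refl (eval N f y) x y ⟩
    (1# - x * y) * eval N f y
      ∎
    where open ≡-Reasoning

  Π1-xy : List Carrier → Carrier → Carrier
  Π1-xy []      y = 1#
  Π1-xy (x ∷ L) y = (1# - x * y) * Π1-xy L y

  Π1-xy′ : List Carrier → Carrier → Carrier
  Π1-xy′ []      y = 0#
  Π1-xy′ (x ∷ L) y = (1# - x * y) * Π1-xy′ L y + - x * Π1-xy L y

  eval-mulΠ1-xz : ∀ L N f y → DegreeBelow N f → eval (length L ℕ.+ N) (mulΠ1-xz L f) y ≡ Π1-xy L y * eval N f y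
  eval-mulΠ1-xz []      N f y deg = sym (*-identityˡ _)
  eval-mulΠ1-xz (x ∷ L) N f y deg =
    trans (eval-mul1-xz _ x _ y (mulΠ1-xz-degree L f deg))
          (trans (cong ((1# - x * y) *_) (eval-mulΠ1-xz L N f y deg)) (sym (*-assoc _ _ _)))

  eval-derivΠ1-xz : ∀ L N f y → DegreeBelow N f → eval (length L ℕ.+ N) (derivΠ1-xz L f) y ≡ Π1-xy′ L y * eval N f y
  eval-derivΠ1-xz []      N f y deg = trans (eval-0 N _ y (λ _ → refl)) (sym (zeroˡ _))
  eval-derivΠ1-xz (x ∷ L) N f y deg = begin
    eval (suc (length L ℕ.+ N)) (mul1-xz x (derivΠ1-xz L f) +ₛ (- x) ·ₛ mulΠ1-xz L f) y
      ≡⟨ eval-+ₛ (suc (length L ℕ.+ N)) (mul1-xz x (derivΠ1-xz L f)) ((- x) ·ₛ mulΠ1-xz L f) y ⟩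
    eval (suc (length L ℕ.+ N)) (mul1-xz x (derivΠ1-xz L f)) y + eval (suc (length L ℕ.+ N)) ((- x) ·ₛ mulΠ1-xz L f) y
      ≡⟨ cong₂ _+_ (eval-mul1-xz _ x _ y (derivΠ1-xz-degree L f (DegreeBelow-mono f (ℕ.n≤1+n N) deg)))
                   (eval-·ₛ (suc (length L ℕ.+ N)) (- x) (mulΠ1-xz L f) y) ⟩
    (1# - x * y) * eval (length L ℕ.+ N) (derivΠ1-xz L f) y + - x * eval (suc (length L ℕ.+ N)) (mulΠ1-xz L f) y
      ≡⟨ cong₂ (λ a b → (1# - x * y) * a + - x * b) (eval-derivΠ1-xz L N f y deg)
               (trans (eval-degree 1 (length L ℕ.+ N) (mulΠ1-xz L f) y (mulΠ1-xz-degree L f deg)) (eval-mulΠ1-xz L N f y deg)) ⟩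
    (1# - x * y) * (Π1-xy′ L y * e) + - x * (Π1-xy L y * e)
      ≡⟨ solve 5 (λ a b c d e → a :* (b :* e) :+ c :* (d :* e) := (a :* b :+ c :* d) :* e) refl (1# - x * y) (Π1-xy′ L y) (- x) (Π1-xy L y) e ⟩
    Π1-xy′ (x ∷ L) y * e
      ∎
    where
    open ≡-Reasoning
    e = eval N f y

  1-x*x⁻¹≡0 : ∀ {x} → ¬ (x ≡ 0#) → 1# - x * x ⁻¹ ≡ 0#
  1-x*x⁻¹≡0 {x} x≢0 = trans (cong (λ z → 1# - z) (*-inverse x x≢0)) (-‿inverseʳ 1#)

  1-y*x⁻¹≡0⇒y≡x : ∀ {x y} → ¬ (x ≡ 0#) → 1# - y * x ⁻¹ ≡ 0# → y ≡ x
  1-y*x⁻¹≡0⇒y≡x {x} {y} x≢0 1-yx⁻¹≡0 = begin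
    y                ≡⟨ sym (*-identityʳ y) ⟩
    y * 1#           ≡⟨ cong (y *_) (sym (x⁻¹*x≡1 x≢0)) ⟩
    y * (x ⁻¹ * x)   ≡⟨ sym (*-assoc _ _ _) ⟩
    (y * x ⁻¹) * x   ≡⟨ cong (_* x) (sym (x-y≡0⇒x≡y 1-yx⁻¹≡0)) ⟩
    1# * x           ≡⟨ *-identityˡ x ⟩
    x                ∎
    where open ≡-Reasoning

  Π1-xy-root : ∀ {x} L → x ∈ L → ¬ (x ≡ 0#) → Π1-xy L (x ⁻¹) ≡ 0#
  Π1-xy-root (x ∷ L) (here refl) x≢0 = trans (cong (_* Π1-xy L _) (1-x*x⁻¹≡0 x≢0)) (zeroˡ _)
  Π1-xy-root (y ∷ L) (there x∈L) x≢0 = trans (cong ((1# - y * _) *_) (Π1-xy-root L x∈L x≢0)) (zeroʳ _)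

  Π1-xy-≢0 : ∀ {x} L → ¬ (x ≡ 0#) → All (λ y → ¬ (x ≡ y)) L → ¬ (Π1-xy L (x ⁻¹) ≡ 0#)
  Π1-xy-≢0 []      x≢0 []          = 1≢0
  Π1-xy-≢0 (y ∷ L) x≢0 (x≢y ∷ x∉L) =
    x*y≢0 (λ 1-yx⁻¹≡0 → x≢y (sym (1-y*x⁻¹≡0⇒y≡x x≢0 1-yx⁻¹≡0))) (Π1-xy-≢0 L x≢0 x∉L)

  Π1-xy′-≢0 : ∀ {x} L → Unique L → x ∈ L → ¬ (x ≡ 0#) → ¬ (Π1-xy′ L (x ⁻¹) ≡ 0#)
  Π1-xy′-≢0 {x} (x ∷ L) (x∉L ∷ _) (here refl) x≢0 Π′≡0 =
    x*y≢0 (-x≢0 x≢0) (Π1-xy-≢0 L x≢0 x∉L) (begin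
      - x * Π1-xy L (x ⁻¹)
        ≡⟨ solve 3 (λ d x p → (:- x) :* p := con (pos 0) :* d :+ (:- x) :* p) refl (Π1-xy′ L (x ⁻¹)) x (Π1-xy L (x ⁻¹)) ⟩
      0# * Π1-xy′ L (x ⁻¹) + - x * Π1-xy L (x ⁻¹)
        ≡⟨ cong (λ a → a * Π1-xy′ L (x ⁻¹) + - x * Π1-xy L (x ⁻¹)) (sym (1-x*x⁻¹≡0 x≢0)) ⟩
      (1# - x * x ⁻¹) * Π1-xy′ L (x ⁻¹) + - x * Π1-xy L (x ⁻¹)
        ≡⟨ Π′≡0 ⟩
      0#
        ∎)
    where open ≡-Reasoning
  Π1-xy′-≢0 {x} (y ∷ L) (y∉L ∷ L!) (there x∈L) x≢0 Π′≡0 =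
    Π1-xy′-≢0 L L! x∈L x≢0 (x*y≡0⇒y≡0 1-yx⁻¹≢0 (begin
      (1# - y * x ⁻¹) * Π1-xy′ L (x ⁻¹)
        ≡⟨ solve 3 (λ a d y → a :* d := a :* d :+ (:- y) :* con (pos 0)) refl (1# - y * x ⁻¹) (Π1-xy′ L (x ⁻¹)) y ⟩
      (1# - y * x ⁻¹) * Π1-xy′ L (x ⁻¹) + - y * 0#
        ≡⟨ cong (λ p → (1# - y * x ⁻¹) * Π1-xy′ L (x ⁻¹) + - y * p) (sym (Π1-xy-root L x∈L x≢0)) ⟩
      (1# - y * x ⁻¹) * Π1-xy′ L (x ⁻¹) + - y * Π1-xy L (x ⁻¹)
        ≡⟨ Π′≡0 ⟩
      0#
        ∎))
    where
    open ≡-Reasoning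
    1-yx⁻¹≢0 : ¬ (1# - y * x ⁻¹ ≡ 0#)
    1-yx⁻¹≢0 1-yx⁻¹≡0 = All.lookup y∉L x∈L (1-y*x⁻¹≡0⇒y≡x x≢0 1-yx⁻¹≡0)

  unique-map-⁻¹ : ∀ L → Unique L → All (λ x → ¬ (x ≡ 0#)) L → Unique (map _⁻¹ L)
  unique-map-⁻¹ []      []          []          = []
  unique-map-⁻¹ (x ∷ L) (x∉L ∷ L!) (x≢0 ∷ L≢0) =
    All.map⁺ (All.zipWith (λ (x≢y , y≢0) x⁻¹≡y⁻¹ → x≢y (⁻¹-injective x≢0 y≢0 x⁻¹≡y⁻¹)) (x∉L , L≢0)) ∷ unique-map-⁻¹ L L! L≢0

module FiniteField (F : Field) {q} (size : HasSize F q) where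
  open Field F
  open FieldProperties F
  open PowerSeries F
  open PolynomialFunctions F
  open CommutativeRing commutativeRing using (+-isCommutativeMonoid)
  private module size = Inverse size

  infix 4 _≟_
  _≟_ : DecidableEquality Carrier
  x ≟ y with size.from x Fin.≟ size.from y
  ... | yes x≡y = yes (trans (sym (size.strictlyInverseˡ x)) (trans (cong size.to x≡y) (size.strictlyInverseˡ y)))
  ... | no  x≢y = no λ x≡y → x≢y (cong size.from x≡y)

  elements : List Carrier
  elements = tabulate size.to

  elements-unique : Unique elements
  elements-unique = Unique.tabulate⁺ λ {i} {j} eq →
    trans (sym (size.strictlyInverseʳ i)) (trans (cong size.from eq) (size.strictlyInverseʳ j))

  ∈-elements : ∀ x → x ∈ elements
  ∈-elements x = subst (_∈ elements) (size.strictlyInverseˡ x) (∈-tabulate⁺ (size.from x))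

  length-elements : length elements ≡ q
  length-elements = length-tabulate size.to

  ↭-elements : ∀ {xs} → Unique xs → (∀ x → x ∈ xs) → xs ↭ elements
  ↭-elements xs! ∈xs = ↭-unique xs! elements-unique (λ {x} _ → ∈-elements x) (λ {x} _ → ∈xs x)

  map-↭-elements : (f : Carrier → Carrier) → (∀ {x y} → f x ≡ f y → x ≡ y) → (∀ y → Σ Carrier λ x → f x ≡ y) →
    map f elements ↭ elements
  map-↭-elements f f-inj f-surj = ↭-elements (Unique.map⁺ f-inj elements-unique) λ y →
    subst (_∈ map f elements) (proj₂ (f-surj y)) (∈-map⁺ f (∈-elements (proj₁ (f-surj y))))

  open import Data.List.Membership.DecPropositional _≟_ public using (_∈?_)

  length-filter-∈ : ∀ {L} → Unique L → length (filter (_∈? L) elements) ≡ length L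
  length-filter-∈ {L} L! = ↭-length (↭-unique (Unique.filter⁺ (_∈? L) elements-unique) L!
    (λ x∈ → proj₂ (∈-filter⁻ (_∈? L) {xs = elements} x∈)) (λ {x} x∈L → ∈-filter⁺ (_∈? L) (∈-elements x) x∈L))

  -- Translation by 1 permutes F, so comparing Σ (x + 1) with Σ x gives q · 1 = 0.
  #q≡0 : # q ≡ 0#
  #q≡0 = begin
    # q
      ≡⟨ cong #_ (sym length-elements) ⟩
    # length elements
      ≡⟨ solve 2 (λ n s → n := (:- s) :+ (s :+ n)) refl (# length elements) (sum elements) ⟩
    - sum elements + (sum elements + # length elements)
      ≡⟨ cong (- sum elements +_) (sym (sum-+1 elements)) ⟩
    - sum elements + sum (map (_+ 1#) elements)
      ≡⟨ cong (- sum elements +_) (Permutationₛ.foldr-commMonoid (setoid Carrier) +-isCommutativeMonoid (↭⇒↭ₛ +1-↭)) ⟩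
    - sum elements + sum elements
      ≡⟨ -‿inverseˡ _ ⟩
    0#
      ∎
    where
    open ≡-Reasoning
    sum : List Carrier → Carrier
    sum = foldr _+_ 0#
    sum-+1 : ∀ xs → sum (map (_+ 1#) xs) ≡ sum xs + # length xs
    sum-+1 []       = sym (+-identityʳ 0#)
    sum-+1 (x ∷ xs) = begin
      (x + 1#) + sum (map (_+ 1#) xs)
        ≡⟨ cong ((x + 1#) +_) (sum-+1 xs) ⟩
      (x + 1#) + (sum xs + # length xs)
        ≡⟨ solve 4 (λ x o s n → (x :+ o) :+ (s :+ n) := (x :+ s) :+ (o :+ n)) refl x 1# (sum xs) (# length xs) ⟩
      (x + sum xs) + (1# + # length xs)
        ≡⟨ cong ((x + sum xs) +_) (sym (#-suc (length xs))) ⟩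
      (x + sum xs) + # suc (length xs)
        ∎
    +1-↭ : map (_+ 1#) elements ↭ elements
    +1-↭ = map-↭-elements (_+ 1#)
      (λ {x} {y} x+1≡y+1 → trans (solve 2 (λ x o → x := (x :+ o) :- o) refl x 1#)
                               (trans (cong (_- 1#) x+1≡y+1) (solve 2 (λ y o → (y :+ o) :- o := y) refl y 1#)))
      (λ y → y - 1# , solve 2 (λ y o → (y :- o) :+ o := y) refl y 1#)

  ∃c≢0∧c^j≢1 : ∀ j → 1 ≤ j → suc j < q → ∃ λ c → ¬ (c ≡ 0#) × ¬ (c ^ j ≡ 1#)
  ∃c≢0∧c^j≢1 j@(suc j′) _ 1+j<q with ∃-≢ _≟_ 0# (Unique.filter⁺ _ elements-unique) 2≤length-nonroots
    where
    is-root = λ y → y ^ j ≟ 1#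
    roots = filter is-root elements
    0^j-1≢0 : ¬ (0# ^ j - 1# ≡ 0#)
    0^j-1≢0 0^j-1≡0 = 0≢1 (trans (sym (zeroˡ (0# ^ j′))) (x-y≡0⇒x≡y 0^j-1≡0))
    length-roots≤j : length roots ≤ j
    length-roots≤j = roots-length≤degree j (PolyFun-+ j (PolyFun-^ j) (PolyFun-const j (- 1#))) 0^j-1≢0 roots
      (Unique.filter⁺ is-root elements-unique)
      (All.map (λ {y} y^j≡1 → trans (cong (_- 1#) y^j≡1) (-‿inverseʳ 1#)) (All.all-filter is-root elements))
    2≤length-nonroots : 2 ≤ length (filter (λ y → ¬? (is-root y)) elements)
    2≤length-nonroots = ℕ.+-cancelˡ-≤ (length roots) 2 _ (begin
      length roots ℕ.+ 2   ≤⟨ ℕ.+-monoˡ-≤ 2 length-roots≤j ⟩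
      j ℕ.+ 2              ≡⟨ ℕ.+-comm j 2 ⟩
      suc (suc j)          ≤⟨ 1+j<q ⟩
      q                    ≡⟨ trans (sym length-elements) (sym (length-filter+filter∁ is-root elements)) ⟩
      length roots ℕ.+ length (filter (λ y → ¬? (is-root y)) elements) ∎)
      where open ℕ.≤-Reasoning
  ... | c , c∈nonroots , c≢0 = c , c≢0 , proj₂ (∈-filter⁻ _ {xs = elements} c∈nonroots)

  -- The series ∏_{x ∈ F} (1 - x z) is invariant under z ↦ c z for c ≠ 0, so its coefficients of degree j
  -- are killed by any c^j ≠ 1.
  mulΠ1-xz-elements-1ₛ : ∀ j → 1 ≤ j → suc j < q → mulΠ1-xz elements 1ₛ j ≡ 0#
  mulΠ1-xz-elements-1ₛ j 1≤j 1+j<q with ∃c≢0∧c^j≢1 j 1≤j 1+j<q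
  ... | c , c≢0 , c^j≢1 = x*y≡0⇒y≡0 c^j-1≢0 [c^j-1]*Eⱼ≡0
    where
    E = mulΠ1-xz elements 1ₛ
    c^j-1≢0 : ¬ (c ^ j - 1# ≡ 0#)
    c^j-1≢0 c^j-1≡0 = c^j≢1 (x-y≡0⇒x≡y c^j-1≡0)
    c*-↭ : map (c *_) elements ↭ elements
    c*-↭ = map-↭-elements (c *_)
      (λ {x} {y} cx≡cy → x-y≡0⇒x≡y (x*y≡0⇒y≡0 c≢0 (trans (solve 3 (λ c x y → c :* (x :- y) := c :* x :- c :* y) refl c x y)
                                                       (trans (cong (_- c * y) cx≡cy) (-‿inverseʳ _)))))
      (λ y → c ⁻¹ * y , trans (sym (*-assoc _ _ _)) (trans (cong (_* y) (*-inverse c c≢0)) (*-identityˡ y)))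
    dilation-invariant : E ≗ dilate c E
    dilation-invariant = begin
      mulΠ1-xz elements 1ₛ                      ≈⟨ mulΠ1-xz-↭ 1ₛ c*-↭ ⟨
      mulΠ1-xz (map (c *_) elements) 1ₛ         ≈⟨ mulΠ1-xz-cong (map (c *_) elements) (dilate-1ₛ c) ⟨
      mulΠ1-xz (map (c *_) elements) (dilate c 1ₛ)
        ≈⟨ mulΠ1-xz-dilate c elements 1ₛ ⟩
      dilate c (mulΠ1-xz elements 1ₛ)           ∎
      where open ≗-Reasoning
    [c^j-1]*Eⱼ≡0 : (c ^ j - 1#) * E j ≡ 0#
    [c^j-1]*Eⱼ≡0 = begin
      (c ^ j - 1#) * E j       ≡⟨ solve 2 (λ p e → (p :- con (pos 1)) :* e := p :* e :- e) refl (c ^ j) (E j) ⟩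
      c ^ j * E j - E j        ≡⟨ cong (_- E j) (sym (dilation-invariant j)) ⟩
      E j - E j                ≡⟨ -‿inverseʳ _ ⟩
      0#                       ∎
      where open ≡-Reasoning

  mulΠ1-xz-elements : ∀ i f → suc i < q → mulΠ1-xz elements f i ≡ f i
  mulΠ1-xz-elements i f 1+i<q = begin
    mulΠ1-xz elements f i
      ≡⟨ mulΠ1-xz-cong elements f≗ i ⟩
    mulΠ1-xz elements (f 0 ·ₛ 1ₛ +ₛ z· f′) i
      ≡⟨ mulΠ1-xz-+ₛ elements _ _ i ⟩
    mulΠ1-xz elements (f 0 ·ₛ 1ₛ) i + mulΠ1-xz elements (z· f′) i
      ≡⟨ cong₂ _+_ (mulΠ1-xz-·ₛ elements (f 0) 1ₛ i) (mulΠ1-xz-z· elements f′ i) ⟩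
    f 0 * mulΠ1-xz elements 1ₛ i + (z· mulΠ1-xz elements f′) i
      ≡⟨ lower-terms i 1+i<q ⟩
    f i
      ∎
    where
    open ≡-Reasoning
    f′ : Series
    f′ j = f (suc j)
    f≗ : f ≗ f 0 ·ₛ 1ₛ +ₛ z· f′
    f≗ zero    = solve 1 (λ a → a := a :* con (pos 1) :+ con (pos 0)) refl (f 0)
    f≗ (suc j) = solve 2 (λ a b → b := a :* con (pos 0) :+ b) refl (f 0) (f (suc j))
    lower-terms : ∀ i → suc i < q → f 0 * mulΠ1-xz elements 1ₛ i + (z· mulΠ1-xz elements f′) i ≡ f i
    lower-terms zero    _     =
      trans (cong (λ e → f 0 * e + 0#) (mulΠ1-xz-lowest elements 1ₛ (λ _ ())))
            (solve 1 (λ a → a :* con (pos 1) :+ con (pos 0) := a) refl (f 0))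
    lower-terms (suc i) 2+i<q =
      trans (cong₂ (λ e g → f 0 * e + g) (mulΠ1-xz-elements-1ₛ (suc i) (s≤s z≤n) 2+i<q)
                                         (mulΠ1-xz-elements i f′ (ℕ.<-trans (ℕ.n<1+n _) 2+i<q)))
            (solve 2 (λ a b → a :* con (pos 0) :+ b := b) refl (f 0) (f (suc i)))

  -- For L without repetitions, ∏_{x ∈ L} (1 - x z)⁻¹ agrees mod z^(q-1) with ∏_{x ∉ L} (1 - x z), a polynomial
  -- of degree q - |L|.
  invΠ1-xz-vanishes : ∀ L → Unique L → ∀ i → q ∸ length L < i → suc i < q → invΠ1-xz L i ≡ 0#
  invΠ1-xz-vanishes L L! i q-l<i 1+i<q = begin
    invΠ1-xz L i                               ≡⟨ mulΠ1-xz-elements i (invΠ1-xz L) 1+i<q ⟨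
    mulΠ1-xz elements (invΠ1-xz L) i           ≡⟨ mulΠ1-xz-↭ (invΠ1-xz L) C++L↭elements i ⟨
    mulΠ1-xz (C ++ L) (invΠ1-xz L) i           ≡⟨ cong (λ g → g i) (mulΠ1-xz-++ C L (invΠ1-xz L)) ⟩
    mulΠ1-xz C (mulΠ1-xz L (invΠ1-xz L)) i     ≡⟨ mulΠ1-xz-cong C (mulΠ1-xz-invΠ1-xz L) i ⟩
    mulΠ1-xz C 1ₛ i                            ≡⟨ mulΠ1-xz-degree C 1ₛ 1ₛ-degree i C+1≤i ⟩
    0#                                         ∎
    where
    open ≡-Reasoning
    ∉L? = λ x → ¬? (x ∈? L)
    C = filter ∉L? elements
    C++L↭elements : C ++ L ↭ elements
    C++L↭elements = ↭-elements (Unique.++⁺ (Unique.filter⁺ ∉L? elements-unique) L! λ (x∈C , x∈L) → proj₂ (∈-filter⁻ ∉L? {xs = elements} x∈C) x∈L)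
      λ x → case x ∈? L of λ where
        (yes x∈L) → ∈-++⁺ʳ C x∈L
        (no  x∉L) → ∈-++⁺ˡ (∈-filter⁺ ∉L? (∈-elements x) x∉L)
    length-C : length C ≡ q ∸ length L
    length-C = begin
      length C
        ≡⟨ ℕ.m+n∸m≡n (length L) (length C) ⟨
      length L ℕ.+ length C ∸ length L
        ≡⟨ cong (λ n → n ℕ.+ length C ∸ length L) (length-filter-∈ L!) ⟨
      length (filter (_∈? L) elements) ℕ.+ length C ∸ length L
        ≡⟨ cong (_∸ length L) (trans (length-filter+filter∁ (_∈? L) elements) length-elements) ⟩
      q ∸ length L
        ∎
    C+1≤i : length C ℕ.+ 1 ≤ i
    C+1≤i = subst (_≤ i) (trans (ℕ.+-comm 1 _) (cong (ℕ._+ 1) (sym length-C))) q-l<i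

  #p≡0 : ∀ {p s} → q ≡ p ℕ.^ s → # p ≡ 0#
  #p≡0 {p} {s} q≡pˢ with # p ≟ 0#
  ... | yes #p≡0 = #p≡0
  ... | no  #p≢0 = ⊥-elim (x^n≢0 s #p≢0 (trans (sym (#-^ p s)) (trans (cong #_ (sym q≡pˢ)) #q≡0)))

  ∃-translate-≢0 : ∀ {n} (b : Fin n → Carrier) → (∀ {i j} → b i ≡ b j → i ≡ j) → n < q → ∃ λ t → ∀ j → ¬ (b j + t ≡ 0#)
  ∃-translate-≢0 {n} b b-inj n<q with ∃-∈ 1≤length-good
    where
    -b = tabulate λ j → - b j
    good = filter (λ t → ¬? (t ∈? -b)) elements
    -b! : Unique -b
    -b! = Unique.tabulate⁺ λ {i} {j} -bi≡-bj → b-inj (trans (sym (⁻¹-involutive (b i))) (trans (cong -_ -bi≡-bj) (⁻¹-involutive (b j))))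
    1≤length-good : 1 ≤ length good
    1≤length-good = ℕ.+-cancelˡ-≤ n 1 (length good) (begin
      n ℕ.+ 1                                            ≡⟨ ℕ.+-comm n 1 ⟩
      suc n                                              ≤⟨ n<q ⟩
      q                                                  ≡⟨ trans (sym length-elements) (sym (length-filter+filter∁ (_∈? -b) elements)) ⟩
      length (filter (_∈? -b) elements) ℕ.+ length good  ≡⟨ cong (ℕ._+ length good) (trans (length-filter-∈ -b!) (length-tabulate _)) ⟩
      n ℕ.+ length good                                  ∎)
      where open ℕ.≤-Reasoning
  ... | t , t∈good = t , λ j bj+t≡0 → proj₂ (∈-filter⁻ _ {xs = elements} t∈good) (subst (_∈ _) (t≡-bj j bj+t≡0) (∈-tabulate⁺ j))
    where
    t≡-bj : ∀ j → b j + t ≡ 0# → - b j ≡ t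
    t≡-bj j bj+t≡0 = sym (trans (solve 2 (λ b t → t := (:- b) :+ (b :+ t)) refl (b j) t) (trans (cong (- b j +_) bj+t≡0) (+-identityʳ _)))

  ∃-≢0-between : ∀ (f : ℕ → Carrier) l u → ¬ (∀ i → l < i → i < u → f i ≡ 0#) → ∃ λ i → l < i × i < u × ¬ (f i ≡ 0#)
  ∃-≢0-between f l u ¬all≡0 with ℕ.anyUpTo? (λ i → l ℕ.<? i ×-dec ¬? (f i ≟ 0#)) u
  ... | yes (i , i<u , l<i , fᵢ≢0) = i , l<i , i<u , fᵢ≢0
  ... | no  ∄i = ⊥-elim (¬all≡0 λ i l<i i<u → decidable-stable (f i ≟ 0#) λ fᵢ≢0 → ∄i (i , i<u , l<i , fᵢ≢0))

prime∤⇒coprime : ∀ {p m} → Prime p → ¬ (p ∣ m) → Coprime m p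
prime∤⇒coprime p-prime p∤m (d∣m , d∣p) with prime⇒irreducible p-prime d∣p
... | inj₁ d≡1  = d≡1
... | inj₂ refl = ⊥-elim (p∤m d∣m)

module Characteristic (F : Field) where
  open Field F
  open FieldProperties F

  1+ya≡xb⇒1≡0 : ∀ {a b} x y → 1 ℕ.+ y ℕ.* a ≡ x ℕ.* b → # a ≡ 0# → # b ≡ 0# → 1# ≡ 0#
  1+ya≡xb⇒1≡0 {a} {b} x y 1+ya≡xb #a≡0 #b≡0 = begin
    1#                   ≡⟨ sym (+-identityʳ 1#) ⟩
    1# + 0#              ≡⟨ cong (1# +_) (sym (trans (cong (# y *_) #a≡0) (zeroʳ _))) ⟩
    1# + # y * # a       ≡⟨ cong (1# +_) (sym (#-* y a)) ⟩
    1# + # (y ℕ.* a)     ≡⟨ sym (#-+ 1 (y ℕ.* a)) ⟩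
    # (1 ℕ.+ y ℕ.* a)    ≡⟨ cong #_ 1+ya≡xb ⟩
    # (x ℕ.* b)          ≡⟨ #-* x b ⟩
    # x * # b            ≡⟨ cong (# x *_) #b≡0 ⟩
    # x * 0#             ≡⟨ zeroʳ _ ⟩
    0#                   ∎
    where open ≡-Reasoning

  -- In characteristic p, Bézout 1 = x m - y p (or y p - x m) turns p ∤ m into m · 1 ≠ 0.
  #m≢0 : ∀ {p m} → Prime p → # p ≡ 0# → ¬ (p ∣ m) → ¬ (# m ≡ 0#)
  #m≢0 p-prime #p≡0 p∤m #m≡0 with coprime-Bézout (prime∤⇒coprime p-prime p∤m)
  ... | Bézout.+- x y 1+yp≡xm = 1≢0 (1+ya≡xb⇒1≡0 x y 1+yp≡xm #p≡0 #m≡0)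
  ... | Bézout.-+ x y 1+xm≡yp = 1≢0 (1+ya≡xb⇒1≡0 y x 1+xm≡yp #m≡0 #p≡0)

module PowerGap (F : Field) where
  open Field F
  open FieldProperties F
  open PowerSeries F
  open PolynomialFunctions F
  open Evaluation F

  private
    -- The argument of the header, with m = 1 + m′ and n = 1 + n₁ = |B|; it shows U′ = ∏_{b ∈ K} (1 - b z) · V.
    module Gap (B : List Carrier) (B! : Unique B) (B≢0 : All (λ b → ¬ (b ≡ 0#)) B)
               (m′ k n₁ : ℕ) (length-B : length B ≡ suc n₁)
               (#m≢0 : ¬ (# suc m′ ≡ 0#)) (#[k+mn]≡0 : # (k ℕ.+ suc m′ ℕ.* suc n₁) ≡ 0#) (k+1<n : suc k < suc n₁)
               (gap : ∀ i → k < i → i < k ℕ.+ suc n₁ → invΠ1-xz (concat (replicate (suc m′) B)) i ≡ 0#) where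

      Bᵐ K : List Carrier
      Bᵐ = concat (replicate (suc m′) B)
      K  = concat (replicate m′ B)

      w : Series
      w = invΠ1-xz Bᵐ

      s : ℕ
      s = k ℕ.+ n₁

      P R U V : Series
      P = truncate (suc k) w
      R j = w j - P j
      U = mulΠ1-xz Bᵐ P
      V = mulΠ1-xz B (deriv P) +ₛ # suc m′ ·ₛ derivΠ1-xz B P

      R-order : OrderAtLeast (k ℕ.+ suc n₁) R
      R-order j j<k+n with ℕ.<-≤-connex j (suc k)
      ... | inj₁ j<1+k = trans (cong (λ p → w j - p) (truncate-< (suc k) w j j<1+k)) (-‿inverseʳ (w j))
      ... | inj₂ 1+k≤j = trans (cong₂ _-_ (gap j 1+k≤j j<k+n) (truncate-degree (suc k) w j 1+k≤j)) (-‿inverseʳ 0#)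

      U-gap : ∀ j → suc j < k ℕ.+ suc n₁ → U (suc j) ≡ 0#
      U-gap j 1+j<k+n = begin
        U (suc j)                              ≡⟨ sym (+-identityʳ _) ⟩
        U (suc j) + 0#                         ≡⟨ cong (U (suc j) +_) (mulΠ1-xz-order Bᵐ R R-order (suc j) 1+j<k+n) ⟨
        U (suc j) + mulΠ1-xz Bᵐ R (suc j)      ≡⟨ mulΠ1-xz-+ₛ Bᵐ P R (suc j) ⟨
        mulΠ1-xz Bᵐ (P +ₛ R) (suc j)           ≡⟨ mulΠ1-xz-cong Bᵐ P+R≗w (suc j) ⟩
        mulΠ1-xz Bᵐ w (suc j)                  ≡⟨ mulΠ1-xz-invΠ1-xz Bᵐ (suc j) ⟩
        0#                                     ∎
        where
        open ≡-Reasoning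
        P+R≗w : P +ₛ R ≗ w
        P+R≗w i = solve 2 (λ p a → p :+ (a :- p) := a) refl (P i) (w i)

      deriv-U-order : OrderAtLeast s (deriv U)
      deriv-U-order j j<s = trans (cong (# suc j *_) (U-gap j (subst (suc (suc j) ≤_) (sym (ℕ.+-suc k n₁)) (s≤s j<s)))) (zeroʳ _)

      length-K : length K ≡ m′ ℕ.* suc n₁
      length-K = trans (length-concat-replicate m′ B) (cong (m′ ℕ.*_) length-B)

      -- length K + s = k + m n - 1 indexes the top coefficient of U′.
      deriv-U-top : deriv U (length K ℕ.+ s) ≡ 0#
      deriv-U-top = trans (cong (_* U (suc (length K ℕ.+ s))) (trans (cong #_ 1+top≡k+mn) #[k+mn]≡0)) (zeroˡ _)
        where
        1+top≡k+mn : suc (length K ℕ.+ s) ≡ k ℕ.+ suc m′ ℕ.* suc n₁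
        1+top≡k+mn = trans (cong (λ l → suc (l ℕ.+ s)) length-K) (arithmetic m′ n₁ k)
          where
          arithmetic : ∀ m n k → suc (m ℕ.* suc n ℕ.+ (k ℕ.+ n)) ≡ k ℕ.+ (suc n ℕ.+ m ℕ.* suc n)
          arithmetic = solve-∀

      deriv-U≗mulΠ1-xz-K-V : deriv U ≗ mulΠ1-xz K V
      deriv-U≗mulΠ1-xz-K-V = begin
        deriv (mulΠ1-xz Bᵐ P)
          ≈⟨ deriv-mulΠ1-xz Bᵐ P ⟩
        mulΠ1-xz Bᵐ (deriv P) +ₛ derivΠ1-xz Bᵐ P
          ≈⟨ +ₛ-cong (mulΠ1-xz-↭ (deriv P) (++-comm B K)) (derivΠ1-xz-power m′ B P) ⟩
        mulΠ1-xz (K ++ B) (deriv P) +ₛ # suc m′ ·ₛ mulΠ1-xz K (derivΠ1-xz B P)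
          ≈⟨ +ₛ-cong (λ j → cong (λ g → g j) (mulΠ1-xz-++ K B (deriv P))) (≗-sym (mulΠ1-xz-·ₛ K (# suc m′) (derivΠ1-xz B P))) ⟩
        mulΠ1-xz K (mulΠ1-xz B (deriv P)) +ₛ mulΠ1-xz K (# suc m′ ·ₛ derivΠ1-xz B P)
          ≈⟨ mulΠ1-xz-+ₛ K _ _ ⟨
        mulΠ1-xz K V
          ∎
        where open ≗-Reasoning

      V-order : OrderAtLeast s V
      V-order = mulΠ1-xz-order⁻ K s V λ j j<s → trans (sym (deriv-U≗mulΠ1-xz-K-V j)) (deriv-U-order j j<s)

      V-degree : DegreeBelow (suc s) V
      V-degree j 1+s≤j = trans (cong₂ (λ a b → a + # suc m′ * b)
                                      (mulΠ1-xz-degree B (deriv P) (deriv-degree P (truncate-degree (suc k) w)) j B+k≤j)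
                                      (derivΠ1-xz-degree B P (truncate-degree (suc k) w) j B+k≤j))
                               (solve 1 (λ c → con (pos 0) :+ c :* con (pos 0) := con (pos 0)) refl (# suc m′))
        where
        B+k≤j : length B ℕ.+ k ≤ j
        B+k≤j = subst (_≤ j) (trans (cong suc (ℕ.+-comm k n₁)) (cong (ℕ._+ k) (sym length-B))) 1+s≤j

      V-top : V s ≡ 0#
      V-top = x*y≡0⇒y≡0 (Π-x-≢0 K K≢0) (trans (*-comm _ _)
                (trans (sym (mulΠ1-xz-top K s V V-degree)) (trans (sym (deriv-U≗mulΠ1-xz-K-V _)) deriv-U-top)))
        where
        K≢0 : All (λ x → ¬ (x ≡ 0#)) K
        K≢0 = All.concat⁺ (All.replicate⁺ m′ B≢0)

      V≗0 : ∀ j → V j ≡ 0#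
      V≗0 j with ℕ.<-cmp j s
      ... | tri< j<s _ _ = V-order j j<s
      ... | tri≈ _ refl _ = V-top
      ... | tri> _ _ s<j = V-degree j s<j

      -- At z = b⁻¹ the factor ∏ (1 - b z) of the first summand of V vanishes.
      P-root : ∀ {b} → b ∈ B → eval (suc k) P (b ⁻¹) ≡ 0#
      P-root {b} b∈B = x*y≡0⇒y≡0 (Π1-xy′-≢0 B B! b∈B b≢0) (x*y≡0⇒y≡0 #m≢0 (begin
        # suc m′ * (Π1-xy′ B r * eval (suc k) P r)
          ≡⟨ sym (+-identityˡ _) ⟩
        0# + # suc m′ * (Π1-xy′ B r * eval (suc k) P r)
          ≡⟨ cong (_+ mΠ′P) (sym (zeroˡ (eval (suc k) (deriv P) r))) ⟩
        0# * eval (suc k) (deriv P) r + # suc m′ * (Π1-xy′ B r * eval (suc k) P r)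
          ≡⟨ cong (λ a → a * eval (suc k) (deriv P) r + mΠ′P) (sym (Π1-xy-root B b∈B b≢0)) ⟩
        Π1-xy B r * eval (suc k) (deriv P) r + # suc m′ * (Π1-xy′ B r * eval (suc k) P r)
          ≡⟨ sym eval-V ⟩
        eval (length B ℕ.+ suc k) V r
          ≡⟨ eval-0 (length B ℕ.+ suc k) V r V≗0 ⟩
        0#
          ∎))
        where
        open ≡-Reasoning
        r = b ⁻¹
        b≢0 = All.lookup B≢0 b∈B
        mΠ′P = # suc m′ * (Π1-xy′ B r * eval (suc k) P r)
        eval-V : eval (length B ℕ.+ suc k) V r ≡ Π1-xy B r * eval (suc k) (deriv P) r + # suc m′ * (Π1-xy′ B r * eval (suc k) P r)
        eval-V = trans (eval-+ₛ (length B ℕ.+ suc k) (mulΠ1-xz B (deriv P)) (# suc m′ ·ₛ derivΠ1-xz B P) r)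
          (cong₂ _+_ (eval-mulΠ1-xz B (suc k) (deriv P) r (DegreeBelow-mono (deriv P) (ℕ.n≤1+n k) (deriv-degree P (truncate-degree (suc k) w))))
                     (trans (eval-·ₛ (length B ℕ.+ suc k) (# suc m′) (derivΠ1-xz B P) r)
                            (cong (# suc m′ *_) (eval-derivΠ1-xz B (suc k) P r (truncate-degree (suc k) w)))))

      absurd : ⊥
      absurd = ℕ.<-irrefl refl (ℕ.<-≤-trans k+1<n (begin
        suc n₁
          ≡⟨ trans (sym length-B) (sym (length-map _⁻¹ B)) ⟩
        length (map _⁻¹ B)
          ≤⟨ roots-length≤degree k (eval-polyFun k P) P0≢0 (map _⁻¹ B) (unique-map-⁻¹ B B! B≢0) (All.map⁺ (All.tabulate P-root)) ⟩
        k
          ≤⟨ ℕ.n≤1+n k ⟩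
        suc k
          ∎))
        where
        open ℕ.≤-Reasoning
        P0≢0 : ¬ (eval (suc k) P 0# ≡ 0#)
        P0≢0 P0≡0 = 1≢0 (trans (sym (trans (eval-at-0 k P) (trans (truncate-< (suc k) w 0 (s≤s z≤n)) (invΠ1-xz-0 Bᵐ)))) P0≡0)

  invΠ1-xz-power-gap : ∀ B → Unique B → All (λ b → ¬ (b ≡ 0#)) B → ∀ m k →
    ¬ (# m ≡ 0#) → # (k ℕ.+ m ℕ.* length B) ≡ 0# → suc k < length B →
    ¬ (∀ i → k < i → i < k ℕ.+ length B → invΠ1-xz (concat (replicate m B)) i ≡ 0#)
  invΠ1-xz-power-gap B B! B≢0 zero     k #0≢0 _ _ _ = #0≢0 refl
  invΠ1-xz-power-gap B B! B≢0 (suc m′) k #m≢0 #[k+mn]≡0 k+1<n gap with length B in length-B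
  ... | suc n₁ = Gap.absurd B B! B≢0 m′ k n₁ length-B #m≢0 #[k+mn]≡0 k+1<n gap

module Directions (F : Field) {m n} (A : Subset F m) (B : Subset F n) where
  open Field F
  open FieldProperties F
  open Subset A using () renaming (elem to a; elem-inj to a-inj)
  open Subset B using () renaming (elem to b; elem-inj to b-inj)

  ∞-isDirection : 1 ≤ m → 2 ≤ n → IsDirection F A B nothing
  ∞-isDirection (s≤s _) (s≤s (s≤s _)) =
    a Fin.zero , a Fin.zero , b Fin.zero , b (Fin.suc Fin.zero) ,
    (Fin.zero , refl) , (Fin.zero , refl) , (Fin.zero , refl) , (Fin.suc Fin.zero , refl) ,
    (λ eq → 0≢1ᶠ (b-inj (cong proj₂ eq))) , inj₁ (refl , refl)
    where
    0≢1ᶠ : ¬ (Fin.zero ≡ Fin.suc Fin.zero)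
    0≢1ᶠ ()

  AtLeastDirections-≤ : ∀ {N N′} → N ≤ N′ → AtLeastDirections F A B N′ → AtLeastDirections F A B N
  AtLeastDirections-≤ N≤N′ (f , f-inj , f-dir) =
    (λ j → f (Fin.inject≤ j N≤N′)) , (λ eq → Fin.inject≤-injective N≤N′ N≤N′ _ _ (f-inj eq)) , (λ j → f-dir _)

  atLeastDirections : 1 ≤ m → 2 ≤ n → ∀ ds → Unique ds → All (λ d → IsDirection F A B (just d)) ds →
    AtLeastDirections F A B (suc (length ds))
  atLeastDirections 1≤m 2≤n ds ds! ds-dir = f , f-inj , f-dir
    where
    f : Fin (suc (length ds)) → Maybe Carrier
    f Fin.zero    = nothing
    f (Fin.suc j) = just (lookup ds j)
    f-inj : Injective _≡_ _≡_ f
    f-inj {Fin.zero}  {Fin.zero}  _  = refl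
    f-inj {Fin.zero}  {Fin.suc _} ()
    f-inj {Fin.suc _} {Fin.zero}  ()
    f-inj {Fin.suc i} {Fin.suc j} eq = cong Fin.suc (lookup-injective ds! i j (just-injective eq))
    f-dir : ∀ j → IsDirection F A B (f j)
    f-dir Fin.zero    = ∞-isDirection 1≤m 2≤n
    f-dir (Fin.suc j) = All.lookup ds-dir (∈-lookup j)

  pairs : List (Fin m × Fin n)
  pairs = cartesianProduct (allFin m) (allFin n)

  intercept : Carrier → Carrier → Fin m × Fin n → Carrier
  intercept t d (x , y) = (b y + t) - d * a x

  Collision : Carrier → Carrier → Set
  Collision t d = Any (λ u → Any (λ v → ¬ (u ≡ v) × intercept t d u ≡ intercept t d v) pairs) pairs

  intercepts-unique : ∀ t d → ¬ Collision t d → Unique (map (intercept t d) pairs)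
  intercepts-unique t d no-collision = Unique.map⁺ intercept-inj (Unique.cartesianProduct⁺ (Unique.allFin⁺ m) (Unique.allFin⁺ n))
    where
    ∈-pairs : ∀ u → u ∈ pairs
    ∈-pairs (x , y) = ∈-cartesianProduct⁺ (∈-allFin x) (∈-allFin y)
    intercept-inj : ∀ {u v} → intercept t d u ≡ intercept t d v → u ≡ v
    intercept-inj {u} {v} eq with ≡-dec Fin._≟_ Fin._≟_ u v
    ... | yes u≡v = u≡v
    ... | no  u≢v = ⊥-elim (no-collision (lose (∈-pairs u) (lose (∈-pairs v) (u≢v , eq))))

  Δb≡d*Δa : ∀ t d x x′ y y′ → intercept t d (x , y) ≡ intercept t d (x′ , y′) → b y - b y′ ≡ d * (a x - a x′)
  Δb≡d*Δa t d x x′ y y′ eq = begin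
    b y - b y′
      ≡⟨ solve 6 (λ u u′ t d v v′ → u :- u′ := d :* (v :- v′) :+ (((u :+ t) :- d :* v) :- ((u′ :+ t) :- d :* v′))) refl (b y) (b y′) t d (a x) (a x′) ⟩
    d * (a x - a x′) + (intercept t d (x , y) - intercept t d (x′ , y′))
      ≡⟨ cong (λ z → d * (a x - a x′) + (z - intercept t d (x′ , y′))) eq ⟩
    d * (a x - a x′) + (intercept t d (x′ , y′) - intercept t d (x′ , y′))
      ≡⟨ cong (d * (a x - a x′) +_) (-‿inverseʳ _) ⟩
    d * (a x - a x′) + 0#
      ≡⟨ +-identityʳ _ ⟩
    d * (a x - a x′)
      ∎
    where open ≡-Reasoning

  collision⇒direction : ∀ t d → Collision t d → IsDirection F A B (just d)
  collision⇒direction t d collision with Any.satisfied collision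
  ... | (x , y) , collision′ with Any.satisfied collision′
  ...   | (x′ , y′) , u≢v , eq with x Fin.≟ x′
  ...     | yes refl = ⊥-elim (u≢v (cong (x ,_) (b-inj (x-y≡0⇒x≡y by-by′≡0))))
    where
    by-by′≡0 : b y - b y′ ≡ 0#
    by-by′≡0 = trans (Δb≡d*Δa t d x x y y′ eq) (trans (cong (d *_) (-‿inverseʳ (a x))) (zeroʳ d))
  ...     | no  x≢x′ = a x′ , a x , b y′ , b y , (x′ , refl) , (x , refl) , (y′ , refl) , (y , refl) ,
                       (λ eq′ → ax≢ax′ (sym (cong proj₁ eq′))) , inj₂ ((λ eq′ → ax≢ax′ (sym eq′)) , cong just (sym slope))
    where
    ax≢ax′ : ¬ (a x ≡ a x′)
    ax≢ax′ ax≡ax′ = x≢x′ (a-inj ax≡ax′)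
    Δa≢0 : ¬ (a x - a x′ ≡ 0#)
    Δa≢0 Δa≡0 = ax≢ax′ (x-y≡0⇒x≡y Δa≡0)
    slope : (b y - b y′) * (a x - a x′) ⁻¹ ≡ d
    slope = begin
      (b y - b y′) * (a x - a x′) ⁻¹            ≡⟨ cong (_* (a x - a x′) ⁻¹) (Δb≡d*Δa t d x x′ y y′ eq) ⟩
      (d * (a x - a x′)) * (a x - a x′) ⁻¹      ≡⟨ *-assoc _ _ _ ⟩
      d * ((a x - a x′) * (a x - a x′) ⁻¹)      ≡⟨ cong (d *_) (*-inverse _ Δa≢0) ⟩
      d * 1#                                    ≡⟨ *-identityʳ d ⟩
      d                                         ∎
      where open ≡-Reasoning

n<m*n : ∀ {m n} → 2 ≤ m → 1 ≤ n → n < m ℕ.* n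
n<m*n {m} {n@(suc _)} 2≤m _ = subst (n <_) (ℕ.*-comm n m) (ℕ.m<m*n n m 2≤m)

complement-lower-bound : ∀ {D E k n M} → D ℕ.+ E ≡ k ℕ.+ M → suc E ≤ k ℕ.+ n → n ≤ M → M ℕ.∸ n ℕ.+ 2 ≤ suc D
complement-lower-bound {D} {E} {k} {n} {M} D+E≡k+M 1+E≤k+n n≤M =
  subst (_≤ suc D) (sym (ℕ.+-suc (M ℕ.∸ n) 1)) (s≤s (ℕ.+-cancelʳ-≤ (k ℕ.+ n) (M ℕ.∸ n ℕ.+ 1) D shifted))
  where
  open ℕ.≤-Reasoning
  rearrange : ∀ x n k → x ℕ.+ 1 ℕ.+ (k ℕ.+ n) ≡ suc (k ℕ.+ (x ℕ.+ n))
  rearrange = solve-∀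
  shifted : M ℕ.∸ n ℕ.+ 1 ℕ.+ (k ℕ.+ n) ≤ D ℕ.+ (k ℕ.+ n)
  shifted = begin
    M ℕ.∸ n ℕ.+ 1 ℕ.+ (k ℕ.+ n)   ≡⟨ rearrange (M ℕ.∸ n) n k ⟩
    suc (k ℕ.+ (M ℕ.∸ n ℕ.+ n))   ≡⟨ cong (λ x → suc (k ℕ.+ x)) (ℕ.m∸n+n≡m n≤M) ⟩
    suc (k ℕ.+ M)                 ≡⟨ cong suc (sym D+E≡k+M) ⟩
    suc (D ℕ.+ E)                 ≡⟨ sym (ℕ.+-suc D E) ⟩
    D ℕ.+ suc E                   ≤⟨ ℕ.+-monoʳ-≤ D 1+E≤k+n ⟩
    D ℕ.+ (k ℕ.+ n)               ∎

module DirectionBound (F : Field) {q} (size : HasSize F q) {m n} (A : Subset F m) (B : Subset F n) where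
  open Field F
  open FieldProperties F
  open PowerSeries F
  open PolynomialFunctions F
  open FiniteField F size
  open PowerGap F
  open Directions F A B
  open Subset A using () renaming (elem to a)
  open Subset B using () renaming (elem to b; elem-inj to b-inj)

  translated : Carrier → List Carrier
  translated t = map (λ y → b y + t) (allFin n)

  length-translated : ∀ t → length (translated t) ≡ n
  length-translated t = trans (length-map _ (allFin n)) (length-tabulate {n = n} (λ y → y))

  translated-unique : ∀ t → Unique (translated t)
  translated-unique t = Unique.map⁺ (λ {y} {y′} eq → b-inj (trans (solve 2 (λ u t → u := (u :+ t) :- t) refl (b y) t)
                                                           (trans (cong (_- t) eq) (solve 2 (λ u t → (u :+ t) :- t := u) refl (b y′) t))))
                                    (Unique.allFin⁺ n)

  intercepts-at-0 : ∀ t → map (intercept t 0#) pairs ≡ concat (replicate m (translated t))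
  intercepts-at-0 t = trans (map-cartesianProduct-proj₂ (intercept t 0#) (λ y → b y + t)
                          (λ x y → solve 2 (λ u v → u :- con (pos 0) :* v := u) refl (b y + t) (a x)) (allFin m) (allFin n))
                        (cong (λ l → concat (replicate l (translated t))) (length-tabulate {n = m} (λ x → x)))

  length-intercepts : ∀ t d → length (map (intercept t d) pairs) ≡ m ℕ.* n
  length-intercepts t d = trans (length-map (intercept t d) pairs)
    (trans (length-cartesianProduct (allFin m) (allFin n)) (cong₂ ℕ._*_ (length-tabulate {n = m} (λ x → x)) (length-tabulate {n = n} (λ y → y))))

  collision? : ∀ t d → Dec (Collision t d)
  collision? t d = Any.any? (λ u → Any.any? (λ v → ¬? (≡-dec Fin._≟_ Fin._≟_ u v) ×-dec (intercept t d u ≟ intercept t d v)) pairs) pairs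

  n<q : ∀ {k} → 2 ≤ m → 2 ≤ n → k ℕ.+ m ℕ.* n ≡ q → n < q
  n<q {k} 2≤m 2≤n k+mn≡q = ℕ.<-≤-trans (n<m*n 2≤m (ℕ.<⇒≤ 2≤n)) (subst (m ℕ.* n ≤_) k+mn≡q (ℕ.m≤n+m (m ℕ.* n) k))

  translated-gap : ∀ t → (∀ y → ¬ (b y + t ≡ 0#)) → ∀ k → ¬ (# m ≡ 0#) → # (k ℕ.+ m ℕ.* n) ≡ 0# → suc k < n →
    ¬ (∀ i → k < i → i < k ℕ.+ n → invΠ1-xz (concat (replicate m (translated t))) i ≡ 0#)
  translated-gap t b+t≢0 k #m≢0 #[k+mn]≡0 k+1<n gap =
    invΠ1-xz-power-gap (translated t) (translated-unique t) (All.map⁺ (All.tabulate λ {y} _ → b+t≢0 y)) m k #m≢0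
      (subst (λ l → # (k ℕ.+ m ℕ.* l) ≡ 0#) (sym (length-translated t)) #[k+mn]≡0)
      (subst (suc k <_) (sym (length-translated t)) k+1<n)
      (λ i k<i i<k+l → gap i k<i (subst (λ l → i < k ℕ.+ l) (length-translated t) i<k+l))

  private
    module Count (k i : ℕ) (t : Carrier) (2≤m : 2 ≤ m) (2≤n : 2 ≤ n) (k+mn≡q : k ℕ.+ m ℕ.* n ≡ q)
                 (k<i : k < i) (i<k+n : i < k ℕ.+ n)
                 (hᵢ≢0 : ¬ (invΠ1-xz (concat (replicate m (translated t))) i ≡ 0#)) where

      T : Carrier → Carrier
      T d = invΠ1-xz (map (intercept t d) pairs) i

      T-polyFun : PolyFun i T
      T-polyFun = invΠ1-xz-polyFun (λ (x , _) → a x) (λ (_ , y) → b y + t) pairs i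

      T0≢0 : ¬ (T 0# ≡ 0#)
      T0≢0 T0≡0 = hᵢ≢0 (trans (cong (λ L → invΠ1-xz L i) (sym (intercepts-at-0 t))) T0≡0)

      nondirections directions : List Carrier
      nondirections = filter (λ d → ¬? (collision? t d)) elements
      directions    = filter (collision? t) elements

      1+i<q : suc i < q
      1+i<q = begin-strict
        suc i          ≤⟨ i<k+n ⟩
        k ℕ.+ n        <⟨ ℕ.+-monoʳ-< k (n<m*n 2≤m (ℕ.<⇒≤ 2≤n)) ⟩
        k ℕ.+ m ℕ.* n  ≡⟨ k+mn≡q ⟩
        q              ∎
        where open ℕ.≤-Reasoning

      q-mn<i : ∀ d → q ℕ.∸ length (map (intercept t d) pairs) < i
      q-mn<i d = subst (_< i) (sym (trans (cong₂ ℕ._∸_ (sym k+mn≡q) (length-intercepts t d)) (ℕ.m+n∸n≡m k (m ℕ.* n)))) k<i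

      nondirections-are-roots : All (λ d → T d ≡ 0#) nondirections
      nondirections-are-roots = All.tabulate λ {d} d∈ →
        invΠ1-xz-vanishes _ (intercepts-unique t d (proj₂ (∈-filter⁻ _ {xs = elements} d∈))) i (q-mn<i d) 1+i<q

      directions-are-directions : All (λ d → IsDirection F A B (just d)) directions
      directions-are-directions = All.tabulate λ {d} d∈ → collision⇒direction t d (proj₂ (∈-filter⁻ (collision? t) {xs = elements} d∈))

      length-directions+nondirections : length directions ℕ.+ length nondirections ≡ k ℕ.+ m ℕ.* n
      length-directions+nondirections = trans (length-filter+filter∁ (collision? t) elements) (trans length-elements (sym k+mn≡q))

      1+length-nondirections≤k+n : suc (length nondirections) ≤ k ℕ.+ n
      1+length-nondirections≤k+n = ℕ.≤-trans (s≤s (roots-length≤degree i T-polyFun T0≢0 nondirections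
                                                     (Unique.filter⁺ _ elements-unique) nondirections-are-roots)) i<k+n

      result : AtLeastDirections F A B (m ℕ.* n ℕ.∸ n ℕ.+ 2)
      result = AtLeastDirections-≤
        (complement-lower-bound length-directions+nondirections 1+length-nondirections≤k+n (ℕ.<⇒≤ (n<m*n 2≤m (ℕ.<⇒≤ 2≤n))))
        (atLeastDirections (ℕ.<⇒≤ 2≤m) 2≤n directions (Unique.filter⁺ _ elements-unique) directions-are-directions)

  directions-bound : ∀ k → 2 ≤ m → 2 ≤ n → ¬ (# m ≡ 0#) → k ℕ.+ m ℕ.* n ≡ q → suc k < n →
    AtLeastDirections F A B (m ℕ.* n ℕ.∸ n ℕ.+ 2)
  directions-bound k 2≤m 2≤n #m≢0 k+mn≡q k+1<n =
    let t , b+t≢0 = ∃-translate-≢0 b b-inj (n<q 2≤m 2≤n k+mn≡q)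
        i , k<i , i<k+n , hᵢ≢0 = ∃-≢0-between (invΠ1-xz (concat (replicate m (translated t)))) k (k ℕ.+ n)
                                   (translated-gap t b+t≢0 k #m≢0 (trans (cong #_ k+mn≡q) #q≡0) k+1<n)
    in Count.result k i t 2≤m 2≤n k+mn≡q k<i i<k+n hᵢ≢0

open import Data.Nat using (_+_; _*_; _^_; _/_; _%_; NonZero)
open import Data.Nat.DivMod using (m≡m%n+[m/n]*n; m%n<n; m*n/n≡m; /-monoˡ-≤)
open import Data.Nat.Divisibility using (m%n≡0⇒n∣m; ∣1⇒≡1)

m∤pˢ : ∀ {p m} s → Prime p → ¬ (p ∣ m) → 2 ≤ m → ¬ (m ∣ p ^ s)
m∤pˢ zero    p-prime p∤m (s≤s (s≤s _)) m∣1 with () ← ∣1⇒≡1 m∣1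
m∤pˢ (suc s) p-prime p∤m 2≤m m∣pˢ⁺¹ = m∤pˢ s p-prime p∤m 2≤m (coprime-divisor (prime∤⇒coprime p-prime p∤m) m∣pˢ⁺¹)

-- (m + 2) m < (m + 1)² ≤ q gives m + 2 ≤ ⌊q/m⌋.
floor-division-bounds : ∀ q m .{{_ : NonZero m}} → ¬ (m ∣ q) → (m + 1) * (m + 1) ≤ q →
  2 ≤ q / m × m * (q / m) < q × suc (q ∸ m * (q / m)) < q / m
floor-division-bounds q m m∤q [m+1]²≤q = ℕ.≤-trans (ℕ.m≤n+m 2 m) m+2≤n , mn<q , 1+r<n
  where
  n = q / m
  square : ∀ m → (m + 2) * m + 1 ≡ (m + 1) * (m + 1)
  square = solve-∀
  m+2≤n : m + 2 ≤ n
  m+2≤n = ℕ.≤-trans (ℕ.≤-reflexive (sym (m*n/n≡m (m + 2) m)))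
            (/-monoˡ-≤ m (ℕ.≤-trans (ℕ.m≤m+n ((m + 2) * m) 1) (ℕ.≤-trans (ℕ.≤-reflexive (square m)) [m+1]²≤q)))
  q≡r+nm : q ≡ q % m + n * m
  q≡r+nm = m≡m%n+[m/n]*n q m
  r≢0 : ¬ (q % m ≡ 0)
  r≢0 r≡0 = m∤q (m%n≡0⇒n∣m q m r≡0)
  mn<q : m * n < q
  mn<q = subst (_< q) (ℕ.*-comm n m) (ℕ.≤-trans (ℕ.+-monoˡ-≤ (n * m) (ℕ.n≢0⇒n>0 r≢0)) (ℕ.≤-reflexive (sym q≡r+nm)))
  1+r<n : suc (q ∸ m * n) < n
  1+r<n = subst (λ r → suc r < n) (sym (trans (cong₂ _∸_ q≡r+nm (ℕ.*-comm m n)) (ℕ.m+n∸n≡m (q % m) (n * m))))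
            (ℕ.≤-trans (s≤s (m%n<n q m)) (ℕ.≤-trans (ℕ.n≤1+n (suc m)) (ℕ.≤-trans (ℕ.≤-reflexive (ℕ.+-comm 2 m)) m+2≤n)))

corollary3p4 : (F : Field) (p s q : ℕ) → Prime p → q ≡ p ^ s → HasSize F q →
    ((m n : ℕ) (A : Subset F m) (B : Subset F n) →
      2 ≤ m → 2 ≤ n → ¬ (p ∣ m) → m * n < q → suc (q ∸ m * n) < n →
      AtLeastDirections F A B (m * n ∸ n + 2))
    ×
    ((m : ℕ) .⦃ _ : NonZero m ⦄ (A : Subset F m) (B : Subset F (q / m)) →
      ¬ (p ∣ m) → 2 ≤ m → (m + 1) * (m + 1) ≤ q →
      AtLeastDirections F A B (m * (q / m) ∸ (q / m) + 2))
corollary3p4 F p s q p-prime q≡pˢ size = bound , bound-for-⌊q/m⌋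
  where
  bound : (m n : ℕ) (A : Subset F m) (B : Subset F n) →
    2 ≤ m → 2 ≤ n → ¬ (p ∣ m) → m * n < q → suc (q ∸ m * n) < n →
    AtLeastDirections F A B (m * n ∸ n + 2)
  bound m n A B 2≤m 2≤n p∤m mn<q k+1<n =
    DirectionBound.directions-bound F size A B (q ∸ m * n) 2≤m 2≤n
      (Characteristic.#m≢0 F p-prime (FiniteField.#p≡0 F size {p} {s} q≡pˢ) p∤m) (ℕ.m∸n+n≡m (ℕ.<⇒≤ mn<q)) k+1<n
  bound-for-⌊q/m⌋ : (m : ℕ) .⦃ _ : NonZero m ⦄ (A : Subset F m) (B : Subset F (q / m)) →
    ¬ (p ∣ m) → 2 ≤ m → (m + 1) * (m + 1) ≤ q →
    AtLeastDirections F A B (m * (q / m) ∸ (q / m) + 2)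
  bound-for-⌊q/m⌋ m A B p∤m 2≤m [m+1]²≤q with floor-division-bounds q m (m∤pˢ s p-prime p∤m 2≤m ∘ subst (m ∣_) q≡pˢ) [m+1]²≤q
  ... | 2≤n , mn<q , k+1<n = bound m (q / m) A B 2≤m 2≤n p∤m mn<q k+1<n
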